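{- Let $n\ge 1$, $m\ge 0$, and let $\mathbf{t}=(t_1,\dots,t_m)$ be a strictly increasing sequence of elements of $[n]$. Then the number of increasing parking completions of $\mathbf{t}$ in $[n]$ is \[ \big|\mathrm{IPC}_n(\mathbf{t})\big| = \sum_{\boldsymbol\ell\in L_n(\mathbf{t})} \prod_{i=1}^{m+1} \frac{1}{\ell_i+1} \binom{2\ell_i}{\ell_i}, \] where \[ L_n(\mathbf{t})= \Big\{\boldsymbol\ell=(\ell_1,\dots,\ell_{m+1})\in\mathbb{N}^{m+1}\ \Big|\ \ell_1+\cdots+\ell_j \geq t_j-j \text{ for all } j\in[m],\ \text{and } \ell_1+\cdots+\ell_{m+1}=n-m \Big\}. \]
   Context: $\mathbb{N}=\{0,1,2,\dots\}$ and $[n]=\{1,\dots,n\}$. Given $\mathbf{t}$, let $\mathbf{u}=(u_1,\dots,u_{n-m})$ be the elements of $[n]\setminus\{t_1,\dots,t_m\}$ in strictly increasing order. An increasing parking completion of $\mathbf{t}$ in $[n]$ is a weakly increasing sequence $(c_1,\dots,c_{n-m})\in[n]^{n-m}$ with $c_i\le u_i$ for all $i$; $\mathrm{IPC}_n(\mathbf{t})$ denotes the set of them. -}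

module Defs where

open import Data.Nat as ℕ using (ℕ; zero; suc; _≤_; _<_; _∸_; _≤?_; _≟_)
open import Data.Nat.Combinatorics using (_C_)
open import Data.Fin using (Fin; toℕ)
open import Data.Fin.Properties using (all?)
open import Data.Vec using (Vec; lookup; toList)
open import Data.List using (List; []; _∷_; map; concatMap; upTo; filter; length; take; foldr)
import Data.List as L
open import Data.Nat.ListAction renaming (sum to sumℕ)
open import Data.List.Membership.DecPropositional _≟_ using (_∈?_)
open import Data.List.Relation.Unary.Linked using (Linked)
import Data.List.Relation.Unary.Linked as Linked
open import Data.List.Relation.Binary.Pointwise using (Pointwise)
import Data.List.Relation.Binary.Pointwise as PW
open import Data.Integer using (+_)
open import Data.Rational using (ℚ; _/_; 0ℚ; 1ℚ) renaming (_+_ to _+ℚ_; _*_ to _*ℚ_)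
open import Data.Product using (_×_)
open import Relation.Binary.PropositionalEquality using (_≡_)
open import Relation.Nullary using (¬?)
open import Relation.Nullary.Decidable using (_×-dec_)

range1 : ℕ → List ℕ
range1 n = map suc (upTo n)

StrictlyIncreasingIn : (n : ℕ) {m : ℕ} → Vec ℕ m → Set
StrictlyIncreasingIn n {m} t =
  (∀ (i : Fin m) → 1 ≤ lookup t i × lookup t i ≤ n) ×
  (∀ (i j : Fin m) → toℕ i < toℕ j → lookup t i < lookup t j)

compl : (n : ℕ) {m : ℕ} → Vec ℕ m → List ℕ
compl n t = filter (λ k → ¬? (k ∈? toList t)) (range1 n)

listsOf : ℕ → List ℕ → List (List ℕ)
listsOf zero xs = [] ∷ []
listsOf (suc k) xs = concatMap (λ x → map (x ∷_) (listsOf k xs)) xs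

-- increasing parking completion of t in [n]:
-- c ∈ [n]^(n-m), weakly increasing, c_i ≤ u_i for all i
-- (membership in [n]^(n-m) is enforced by the enumeration in IPC below)
IsIPC : (n : ℕ) {m : ℕ} → Vec ℕ m → List ℕ → Set
IsIPC n t c = Linked _≤_ c × Pointwise _≤_ c (compl n t)

isIPC? : (n : ℕ) {m : ℕ} (t : Vec ℕ m) (c : List ℕ) → Relation.Nullary.Dec (IsIPC n t c)
isIPC? n t c = Linked.linked? _≤?_ c ×-dec PW.decidable _≤?_ c (compl n t)

-- IPC_n(t) as an explicit duplicate-free list: the elements of [n]^(n-m) satisfying IsIPC
IPC : (n : ℕ) {m : ℕ} → Vec ℕ m → List (List ℕ)
IPC n {m} t = filter (isIPC? n t) (listsOf (n ∸ m) (range1 n))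

-- ℓ ∈ L_n(t) condition (ℓ ∈ ℕ^(m+1) with sum n-m enforced by enumeration below):
-- ℓ_1 + ... + ℓ_j ≥ t_j - j for all j ∈ [m]  (j = toℕ i + 1)
PrefixCond : {m : ℕ} → Vec ℕ m → List ℕ → Set
PrefixCond {m} t ℓ = ∀ (i : Fin m) → lookup t i ∸ suc (toℕ i) ≤ sumℕ (take (suc (toℕ i)) ℓ)

IsL : (n : ℕ) {m : ℕ} → Vec ℕ m → List ℕ → Set
IsL n {m} t ℓ = PrefixCond t ℓ × sumℕ ℓ ≡ n ∸ m

isL? : (n : ℕ) {m : ℕ} (t : Vec ℕ m) (ℓ : List ℕ) → Relation.Nullary.Dec (IsL n t ℓ)
isL? n {m} t ℓ = all? (λ i → lookup t i ∸ suc (toℕ i) ≤? sumℕ (take (suc (toℕ i)) ℓ))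
                 ×-dec (sumℕ ℓ ≟ n ∸ m)

-- L_n(t): all ℓ ∈ {0..n-m}^(m+1) (which contains every ℓ ∈ ℕ^(m+1) of sum n-m) satisfying IsL
Lset : (n : ℕ) {m : ℕ} → Vec ℕ m → List (List ℕ)
Lset n {m} t = filter (isL? n t) (listsOf (suc m) (upTo (suc (n ∸ m))))

catQ : ℕ → ℚ
catQ l = (+ 1 / suc l) *ℚ (+ ((2 ℕ.* l) C l) / 1)

prodQ : List ℚ → ℚ
prodQ = foldr _*ℚ_ 1ℚ

sumQ : List ℚ → ℚ
sumQ = foldr _+ℚ_ 0ℚ

ℕtoℚ : ℕ → ℚ
ℕtoℚ k = + k / 1

-- Encode an increasing parking completion c of t by its surplus path
-- s_v = #{i | c_i ≤ v} − #{i | u_i ≤ v}, v = 0, …, n: it starts and ends at 0, stays ≥ 0, and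
-- satisfies s_v ≥ s_(v-1) − 1 if v ∉ t and s_v ≥ s_(v-1) if v ∈ t. Without elements of t,
-- such paths of length k from height h to 0 are counted by ballot numbers, the Catalan number
-- C(2k,k)/(k+1) being the case h = 0. The free upward jump at each t_j is absorbed by the
-- convolution identity of ballot numbers, which splits off a new Catalan factor; the prefix
-- condition ℓ₁ + ⋯ + ℓ_j ≥ t_j − j records that t_j comes after t_j − j of the values u_i.

module Submission where

open import Defs
open import Data.Nat using (ℕ; _≤_)
open import Data.Vec using (Vec)
open import Data.List using (length; map)
open import Data.Rational using (ℚ)
open import Relation.Binary.PropositionalEquality using (_≡_)

open import Data.Nat using (zero; suc; pred; _+_; _*_; _∸_; _<_; _≤ᵇ_; _≡ᵇ_; _≟_; _≤?_; z≤n; s≤s; s≤s⁻¹)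
open import Data.Bool using (Bool; true; false; not; _∧_; T)
open import Data.Bool.Properties using (∧-zeroʳ; ∧-identityʳ; T-∧)
open import Data.Fin as Fin using (toℕ)
import Data.Integer as ℤ
import Data.Integer.Properties as ℤ
open import Data.List using (List; []; _∷_; _++_; concatMap; filter; drop; take; applyUpTo; upTo)
open import Data.List.Properties using (map-∘; map-cong; map-applyUpTo; length-drop; drop-drop)
open import Data.List.Membership.DecPropositional _≟_ using (_∈?_; _∈_)
open import Data.List.Relation.Binary.Pointwise using (Pointwise; []; _∷_)
open import Data.List.Relation.Unary.All using (All; []; _∷_)
open import Data.List.Relation.Unary.All.Properties using (drop⁺; filter⁺)
open import Data.List.Relation.Unary.Any using (here; there)
open import Data.List.Relation.Unary.Linked as Linked using (Linked; []; [-]; _∷_)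
open import Data.Nat.Combinatorics using (_C_; nCk+nC[k+1]≡[n+1]C[k+1]; nCn≡1; nC1≡n; nCk≡nC[n∸k]; k>n⇒nCk≡0)
open import Data.Nat.ListAction using (sum; product)
open import Data.Nat.Properties
open import Algebra.Properties.CommutativeSemigroup +-commutativeSemigroup using (interchange; x∙yz≈y∙xz)
open import Data.Nat.Tactic.RingSolver using (solve-∀)
open import Data.Product using (_×_; _,_; proj₁; proj₂)
open import Data.Rational as ℚ using (_/_; toℚᵘ)
open import Data.Rational.Properties using (toℚᵘ-injective; toℚᵘ-fromℚᵘ; toℚᵘ-homo-+; toℚᵘ-homo-*)
open import Data.Rational.Unnormalised as ℚᵘ using (ℚᵘ; mkℚᵘ; *≡*)
import Data.Rational.Unnormalised.Properties as ℚᵘ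
open import Data.Sum using (inj₁; inj₂)
open import Data.Vec using ([]; _∷_; lookup; toList)
open import Data.Vec.Functional as Vector using (Vector; head; tail)
open import Function using (_∘_; Equivalence)
open import Relation.Binary using (tri<; tri≈; tri>)
open import Relation.Binary.PropositionalEquality using (refl; sym; trans; cong; cong₂; subst; _≢_; ≢-sym; module ≡-Reasoning)
import Relation.Binary.Reasoning.Setoid as SetoidReasoning
open import Relation.Nullary using (Dec; does; proof; yes; no; ¬_; ¬?; contradiction)
open import Relation.Nullary.Decidable using (dec-true; dec-false)
open import Relation.Nullary.Reflects using (det; fromEquivalence)
open import Relation.Unary using (Pred; Decidable)

open ≡-Reasoning
module ≃ = SetoidReasoning ℚᵘ.≃-setoid

∑< : ℕ → (ℕ → ℕ) → ℕ
∑< zero    f = 0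
∑< (suc n) f = f 0 + ∑< n (f ∘ suc)

infix 6.5 ∑<
syntax ∑< n (λ i → e) = ∑[ i < n ] e

∑<-cong : ∀ n {f g : ℕ → ℕ} → (∀ i → i < n → f i ≡ g i) → ∑< n f ≡ ∑< n g
∑<-cong zero    eq = refl
∑<-cong (suc n) eq = cong₂ _+_ (eq 0 (s≤s z≤n)) (∑<-cong n (λ i i<n → eq (suc i) (s≤s i<n)))

∑<-zero : ∀ n {f : ℕ → ℕ} → (∀ i → i < n → f i ≡ 0) → ∑< n f ≡ 0
∑<-zero zero    eq = refl
∑<-zero (suc n) eq = cong₂ _+_ (eq 0 (s≤s z≤n)) (∑<-zero n (λ i i<n → eq (suc i) (s≤s i<n)))

∑<-suc : ∀ n (f : ℕ → ℕ) → ∑< (suc n) f ≡ ∑< n f + f n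
∑<-suc zero    f = +-comm (f 0) 0
∑<-suc (suc n) f = begin
  f 0 + ∑< (suc n) (f ∘ suc)   ≡⟨ cong (f 0 +_) (∑<-suc n (f ∘ suc)) ⟩
  f 0 + (∑< n (f ∘ suc) + f (suc n)) ≡⟨ +-assoc (f 0) _ _ ⟨
  f 0 + ∑< n (f ∘ suc) + f (suc n)   ∎

∑<-+ : ∀ n (f g : ℕ → ℕ) → ∑[ i < n ] (f i + g i) ≡ ∑< n f + ∑< n g
∑<-+ zero    f g = refl
∑<-+ (suc n) f g = begin
  f 0 + g 0 + ∑[ i < n ] (f (suc i) + g (suc i))     ≡⟨ cong (f 0 + g 0 +_) (∑<-+ n (f ∘ suc) (g ∘ suc)) ⟩
  f 0 + g 0 + (∑< n (f ∘ suc) + ∑< n (g ∘ suc))     ≡⟨ interchange (f 0) (g 0) _ _ ⟩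
  f 0 + ∑< n (f ∘ suc) + (g 0 + ∑< n (g ∘ suc))     ∎

*-distribˡ-∑< : ∀ n c (f : ℕ → ℕ) → c * ∑< n f ≡ ∑[ i < n ] (c * f i)
*-distribˡ-∑< zero    c f = *-zeroʳ c
*-distribˡ-∑< (suc n) c f = trans (*-distribˡ-+ c (f 0) _) (cong (c * f 0 +_) (*-distribˡ-∑< n c (f ∘ suc)))

*-distribʳ-∑< : ∀ n c (f : ℕ → ℕ) → ∑< n f * c ≡ ∑[ i < n ] (f i * c)
*-distribʳ-∑< n c f = begin
  ∑< n f * c           ≡⟨ *-comm (∑< n f) c ⟩
  c * ∑< n f           ≡⟨ *-distribˡ-∑< n c f ⟩
  ∑[ i < n ] (c * f i) ≡⟨ ∑<-cong n (λ i _ → *-comm c (f i)) ⟩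
  ∑[ i < n ] (f i * c) ∎

∑<-comm : ∀ n m (f : ℕ → ℕ → ℕ) → ∑[ i < n ] ∑[ j < m ] f i j ≡ ∑[ j < m ] ∑[ i < n ] f i j
∑<-comm zero    m f = sym (∑<-zero m (λ _ _ → refl))
∑<-comm (suc n) m f = begin
  ∑< m (f 0) + ∑[ i < n ] ∑[ j < m ] f (suc i) j ≡⟨ cong (∑< m (f 0) +_) (∑<-comm n m (f ∘ suc)) ⟩
  ∑< m (f 0) + ∑[ j < m ] ∑[ i < n ] f (suc i) j ≡⟨ ∑<-+ m (f 0) _ ⟨
  ∑[ j < m ] (f 0 j + ∑[ i < n ] f (suc i) j)   ∎

∑<-split : ∀ a b (f : ℕ → ℕ) → ∑< (a + b) f ≡ ∑< a f + ∑[ i < b ] f (a + i)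
∑<-split zero    b f = refl
∑<-split (suc a) b f = trans (cong (f 0 +_) (∑<-split a b (f ∘ suc))) (sym (+-assoc (f 0) _ _))

∑<-vanishing-tail : ∀ a n (f : ℕ → ℕ) → a ≤ n → (∀ i → a ≤ i → i < n → f i ≡ 0) → ∑< n f ≡ ∑< a f
∑<-vanishing-tail a n f a≤n vanish = begin
  ∑< n f                                 ≡⟨ cong (λ z → ∑< z f) (m+[n∸m]≡n a≤n) ⟨
  ∑< (a + (n ∸ a)) f                     ≡⟨ ∑<-split a (n ∸ a) f ⟩
  ∑< a f + ∑[ i < n ∸ a ] f (a + i)      ≡⟨ cong (∑< a f +_) (∑<-zero (n ∸ a) tail-vanishes) ⟩
  ∑< a f + 0                             ≡⟨ +-identityʳ _ ⟩
  ∑< a f                                 ∎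
  where
  tail-vanishes : ∀ i → i < n ∸ a → f (a + i) ≡ 0
  tail-vanishes i i<n∸a = vanish (a + i) (m≤m+n a i) (subst (a + i <_) (m+[n∸m]≡n a≤n) (+-monoʳ-< a i<n∸a))

∑<-triangle : ∀ M (f : ℕ → ℕ → ℕ) →
  ∑[ y < suc M ] ∑[ x < suc y ] f x y ≡ ∑[ x < suc M ] ∑[ z < suc (M ∸ x) ] f x (x + z)
∑<-triangle zero    f = refl
∑<-triangle (suc M) f = begin
  ∑[ y < suc (suc M) ] ∑[ x < suc y ] f x y
    ≡⟨ ∑<-suc (suc M) (λ y → ∑[ x < suc y ] f x y) ⟩
  ∑[ y < suc M ] ∑[ x < suc y ] f x y + ∑[ x < suc (suc M) ] f x (suc M)
    ≡⟨ cong₂ _+_ (∑<-triangle M f) (∑<-suc (suc M) (λ x → f x (suc M))) ⟩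
  ∑< (suc M) rows + (∑[ x < suc M ] f x (suc M) + f (suc M) (suc M))
    ≡⟨ +-assoc (∑< (suc M) rows) _ _ ⟨
  ∑< (suc M) rows + ∑[ x < suc M ] f x (suc M) + f (suc M) (suc M)
    ≡⟨ cong₂ _+_ (∑<-+ (suc M) rows (λ x → f x (suc M))) (cong (f (suc M)) (+-identityʳ (suc M))) ⟨
  ∑[ x < suc M ] (rows x + f x (suc M)) + f (suc M) (suc M + 0)
    ≡⟨ cong (_+ f (suc M) (suc M + 0)) (∑<-cong (suc M) (λ x x≤M → extend-row x (s≤s⁻¹ x≤M))) ⟩
  ∑[ x < suc M ] ∑[ z < suc (suc M ∸ x) ] f x (x + z) + f (suc M) (suc M + 0)
    ≡⟨ cong (∑[ x < suc M ] ∑[ z < suc (suc M ∸ x) ] f x (x + z) +_) (+-identityʳ _) ⟨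
  ∑[ x < suc M ] ∑[ z < suc (suc M ∸ x) ] f x (x + z) + ∑[ z < 1 ] f (suc M) (suc M + z)
    ≡⟨ cong (λ d → ∑[ x < suc M ] ∑[ z < suc (suc M ∸ x) ] f x (x + z) + ∑[ z < suc d ] f (suc M) (suc M + z)) (n∸n≡0 M) ⟨
  ∑[ x < suc M ] ∑[ z < suc (suc M ∸ x) ] f x (x + z) + ∑[ z < suc (suc M ∸ suc M) ] f (suc M) (suc M + z)
    ≡⟨ ∑<-suc (suc M) (λ x → ∑[ z < suc (suc M ∸ x) ] f x (x + z)) ⟨
  ∑[ x < suc (suc M) ] ∑[ z < suc (suc M ∸ x) ] f x (x + z) ∎
  where
  rows : ℕ → ℕ
  rows x = ∑[ z < suc (M ∸ x) ] f x (x + z)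
  extend-row : ∀ x → x ≤ M → rows x + f x (suc M) ≡ ∑[ z < suc (suc M ∸ x) ] f x (x + z)
  extend-row x x≤M = begin
    rows x + f x (suc M)                    ≡⟨ cong (λ z → rows x + f x z) (trans (+-suc x (M ∸ x)) (cong suc (m+[n∸m]≡n x≤M))) ⟨
    rows x + f x (x + suc (M ∸ x))          ≡⟨ ∑<-suc (suc (M ∸ x)) (λ z → f x (x + z)) ⟨
    ∑[ z < suc (suc (M ∸ x)) ] f x (x + z)  ≡⟨ cong (λ d → ∑[ z < suc d ] f x (x + z)) (+-∸-assoc 1 x≤M) ⟨
    ∑[ z < suc (suc M ∸ x) ] f x (x + z)    ∎

∑<-isolate : ∀ n j {f g : ℕ → ℕ} → j < n → (∀ i → i ≢ j → f i ≡ g i) → g j ≡ 0 → ∑< n f ≡ f j + ∑< n g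
∑<-isolate (suc n) zero    {f} {g} _         f≗g gj≡0 =
  cong₂ (λ x y → f 0 + (x + y)) (sym gj≡0) (∑<-cong n (λ i _ → f≗g (suc i) λ ()))
∑<-isolate (suc n) (suc j) {f} {g} (s≤s j<n) f≗g gj≡0 = begin
  f 0 + ∑< n (f ∘ suc)
    ≡⟨ cong₂ _+_ (f≗g 0 λ ()) (∑<-isolate n j j<n (λ i i≢j → f≗g (suc i) (i≢j ∘ suc-injective)) gj≡0) ⟩
  g 0 + (f (suc j) + ∑< n (g ∘ suc)) ≡⟨ x∙yz≈y∙xz (g 0) (f (suc j)) _ ⟩
  f (suc j) + (g 0 + ∑< n (g ∘ suc)) ∎

when : Bool → ℕ → ℕ
when true  n = n
when false n = 0

when-∑< : ∀ b n (f : ℕ → ℕ) → when b (∑< n f) ≡ ∑[ i < n ] when b (f i)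
when-∑< true  n f = refl
when-∑< false n f = sym (∑<-zero n (λ _ _ → refl))

when-*ˡ : ∀ b c n → when b (c * n) ≡ c * when b n
when-*ˡ true  c n = refl
when-*ˡ false c n = sym (*-zeroʳ c)

≤ᵇ-true : ∀ {m n} → m ≤ n → (m ≤ᵇ n) ≡ true
≤ᵇ-true = dec-true (_ ≤? _)

≤ᵇ-false : ∀ {m n} → n < m → (m ≤ᵇ n) ≡ false
≤ᵇ-false n<m = dec-false (_ ≤? _) (<⇒≱ n<m)

∑<-delta : ∀ N M (f : ℕ → ℕ) → M < N → ∑[ x < N ] when (x ≡ᵇ M) (f x) ≡ f M
∑<-delta N M f M<N = begin
  ∑[ x < N ] when (x ≡ᵇ M) (f x)        ≡⟨ ∑<-isolate N M {g = λ _ → 0} M<N off-diagonal refl ⟩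
  when (M ≡ᵇ M) (f M) + ∑[ x < N ] 0    ≡⟨ cong₂ _+_ (cong (λ b → when b (f M)) (dec-true (M ≟ M) refl)) (∑<-zero N (λ _ _ → refl)) ⟩
  f M + 0                               ≡⟨ +-identityʳ (f M) ⟩
  f M                                   ∎
  where
  off-diagonal : ∀ i → i ≢ M → when (i ≡ᵇ M) (f i) ≡ 0
  off-diagonal i i≢M = cong (λ b → when b (f i)) (dec-false (i ≟ M) i≢M)

∑<-restrict : ∀ N M (b : ℕ → Bool) (f : ℕ → ℕ) → M ≤ N →
  ∑[ x < suc N ] when (b x ∧ (x ≤ᵇ M)) (f x) ≡ ∑[ x < suc M ] when (b x) (f x)
∑<-restrict N M b f M≤N = begin
  ∑[ x < suc N ] when (b x ∧ (x ≤ᵇ M)) (f x)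
    ≡⟨ ∑<-vanishing-tail (suc M) (suc N) (λ x → when (b x ∧ (x ≤ᵇ M)) (f x)) (s≤s M≤N)
         (λ x M<x _ → cong (λ c → when c (f x)) (trans (cong (b x ∧_) (≤ᵇ-false M<x)) (∧-zeroʳ (b x)))) ⟩
  ∑[ x < suc M ] when (b x ∧ (x ≤ᵇ M)) (f x)
    ≡⟨ ∑<-cong (suc M) {g = λ x → when (b x) (f x)}
         (λ x x≤M → cong (λ c → when c (f x)) (trans (cong (b x ∧_) (≤ᵇ-true (s≤s⁻¹ x≤M))) (∧-identityʳ (b x)))) ⟩
  ∑[ x < suc M ] when (b x) (f x) ∎

-- Ballot and Catalan numbers

-- ballot h k counts the sequences h = s₀, s₁, …, s_k = 0 of naturals with s_(j+1) ≥ s_j ∸ 1;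
-- the bound on i loses nothing, as a path from height above its remaining length cannot reach 0.
ballot : ℕ → ℕ → ℕ
ballot h       (suc k) = ∑[ i < suc k ] ballot (pred h + i) k
ballot zero    zero    = 1
ballot (suc h) zero    = 0

catalan : ℕ → ℕ
catalan = ballot 0

ballot-vanish : ∀ {h} k → k < h → ballot h k ≡ 0
ballot-vanish {suc h}       zero    _         = refl
ballot-vanish {suc (suc h)} (suc k) (s≤s k<h) =
  ∑<-zero (suc k) (λ i _ → ballot-vanish k (≤-trans k<h (m≤m+n (suc h) i)))

ballot-suc : ∀ h k A → suc k ≤ A → ∑[ i < A ] ballot (pred h + i) k ≡ ballot h (suc k)
ballot-suc h k A k<A = ∑<-vanishing-tail (suc k) A _ k<A
  (λ i k<i _ → ballot-vanish k (≤-trans k<i (m≤n+m i (pred h))))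

private
  shift-zero : ∀ h i → suc (h + i) ≡ h + 0 + suc i
  shift-zero = solve-∀
  shift-suc : ∀ h g i → suc (h + (g + i)) ≡ h + suc g + i
  shift-suc = solve-∀
  high-enough : ∀ h g k → h + g + suc (suc k) ≡ h + suc g + suc k
  high-enough = solve-∀

ballot-suc-split : ∀ k h g → ∑[ i < suc k ] ballot (suc (h + (pred g + i))) (suc k) + ballot h (suc k) * ballot g 0
                         ≡ ballot (suc (h + g)) (suc (suc k))
ballot-suc-split k h zero = begin
  ∑[ i < suc k ] ballot (suc (h + i)) (suc k) + ballot h (suc k) * 1
    ≡⟨ cong₂ _+_ (∑<-cong (suc k) (λ i _ → cong (λ z → ballot z (suc k)) (shift-zero h i))) (*-identityʳ (ballot h (suc k))) ⟩
  ∑[ i < suc k ] ballot (h + 0 + suc i) (suc k) + ballot h (suc k)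
    ≡⟨ +-comm _ (ballot h (suc k)) ⟩
  ballot h (suc k) + ∑[ i < suc k ] ballot (h + 0 + suc i) (suc k)
    ≡⟨ cong (λ z → ballot z (suc k) + ∑[ i < suc k ] ballot (h + 0 + suc i) (suc k)) (trans (+-identityʳ _) (+-identityʳ h)) ⟨
  ballot (suc (h + 0)) (suc (suc k)) ∎
ballot-suc-split k h (suc g) = begin
  ∑[ i < suc k ] ballot (suc (h + (g + i))) (suc k) + ballot h (suc k) * 0
    ≡⟨ cong₂ _+_ (∑<-cong (suc k) (λ i _ → cong (λ z → ballot z (suc k)) (shift-suc h g i))) (*-zeroʳ (ballot h (suc k))) ⟩
  ∑[ i < suc k ] ballot (h + suc g + i) (suc k) + 0
    ≡⟨ cong (∑[ i < suc k ] ballot (h + suc g + i) (suc k) +_) (ballot-vanish (suc k) (≤-trans (m≤n+m _ (h + g)) (≤-reflexive (high-enough h g k)))) ⟨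
  ∑[ i < suc k ] ballot (h + suc g + i) (suc k) + ballot (h + suc g + suc k) (suc k)
    ≡⟨ ∑<-suc (suc k) (λ i → ballot (h + suc g + i) (suc k)) ⟨
  ballot (suc (h + suc g)) (suc (suc k)) ∎

ballot-convolution : ∀ k h g →
  ∑[ j < suc k ] ballot h j * ballot g (k ∸ j) ≡ ballot (suc (h + g)) (suc k)
ballot-convolution zero    zero    zero    = refl
ballot-convolution zero    zero    (suc g) = refl
ballot-convolution zero    (suc h) g       = refl
ballot-convolution (suc k) h       g       = begin
  ∑[ j < suc (suc k) ] ballot h j * ballot g (suc k ∸ j)
    ≡⟨ ∑<-suc (suc k) (λ j → ballot h j * ballot g (suc k ∸ j)) ⟩
  ∑[ j < suc k ] ballot h j * ballot g (suc k ∸ j) + ballot h (suc k) * ballot g (k ∸ k)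
    ≡⟨ cong₂ _+_ first-steps (cong (λ d → ballot h (suc k) * ballot g d) (n∸n≡0 k)) ⟩
  ∑[ i < suc k ] ballot (suc (h + (pred g + i))) (suc k) + ballot h (suc k) * ballot g 0
    ≡⟨ ballot-suc-split k h g ⟩
  ballot (suc (h + g)) (suc (suc k)) ∎
  where
  first-steps : ∑[ j < suc k ] ballot h j * ballot g (suc k ∸ j)
              ≡ ∑[ i < suc k ] ballot (suc (h + (pred g + i))) (suc k)
  first-steps = begin
    ∑[ j < suc k ] ballot h j * ballot g (suc k ∸ j)
      ≡⟨ ∑<-cong (suc k) (λ j j≤k → cong (λ d → ballot h j * ballot g d) (+-∸-assoc 1 (s≤s⁻¹ j≤k))) ⟩
    ∑[ j < suc k ] ballot h j * ballot g (suc (k ∸ j))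
      ≡⟨ ∑<-cong (suc k) (λ j _ → cong (ballot h j *_) (ballot-suc g (k ∸ j) (suc k) (s≤s (m∸n≤m k j)))) ⟨
    ∑[ j < suc k ] ballot h j * (∑[ i < suc k ] ballot (pred g + i) (k ∸ j))
      ≡⟨ ∑<-cong (suc k) (λ j _ → *-distribˡ-∑< (suc k) (ballot h j) (λ i → ballot (pred g + i) (k ∸ j))) ⟩
    ∑[ j < suc k ] ∑[ i < suc k ] ballot h j * ballot (pred g + i) (k ∸ j)
      ≡⟨ ∑<-comm (suc k) (suc k) (λ j i → ballot h j * ballot (pred g + i) (k ∸ j)) ⟩
    ∑[ i < suc k ] ∑[ j < suc k ] ballot h j * ballot (pred g + i) (k ∸ j)
      ≡⟨ ∑<-cong (suc k) (λ i _ → ballot-convolution k h (pred g + i)) ⟩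
    ∑[ i < suc k ] ballot (suc (h + (pred g + i))) (suc k) ∎
private
  2*suc : ∀ k → 2 * suc k ≡ suc (suc (2 * k))
  2*suc = solve-∀

  2*k≡k+k : ∀ k → 2 * k ≡ k + k
  2*k≡k+k = solve-∀

  1+2*k≡[1+k]+k : ∀ k → suc (2 * k) ≡ suc k + k
  1+2*k≡[1+k]+k = solve-∀

  exchange : ∀ x y b d → (x + y) + (b + d) ≡ (x + d) + (y + b)
  exchange = solve-∀

  pascal-rearrange : ∀ x b d → x + (b + d) ≡ (x + d) + b
  pascal-rearrange = solve-∀

  absorb-rearrange : ∀ k a b → suc (suc k) * (a + b) ≡ a + suc k * a + suc (suc k) * b
  absorb-rearrange = solve-∀

  middle-binomial-symmetric : ∀ k → suc (2 * k) C k ≡ suc (2 * k) C suc k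
  middle-binomial-symmetric k = begin
    suc (2 * k) C k                 ≡⟨ nCk≡nC[n∸k] (≤-trans (m≤n+m k (suc k)) (≤-reflexive (sym (1+2*k≡[1+k]+k k)))) ⟩
    suc (2 * k) C (suc (2 * k) ∸ k) ≡⟨ cong (λ n → suc (2 * k) C (n ∸ k)) (1+2*k≡[1+k]+k k) ⟩
    suc (2 * k) C (suc k + k ∸ k)   ≡⟨ cong (suc (2 * k) C_) (m+n∸n≡m (suc k) k) ⟩
    suc (2 * k) C suc k             ∎

suc-*-C-suc : ∀ n k → suc k * (suc n C suc k) ≡ suc n * (n C k)
suc-*-C-suc zero    zero    = refl
suc-*-C-suc zero    (suc k) = begin
  suc (suc k) * (1 C suc (suc k)) ≡⟨ cong (suc (suc k) *_) (k>n⇒nCk≡0 {1} {suc (suc k)} (s≤s (s≤s z≤n))) ⟩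
  suc (suc k) * 0                 ≡⟨ *-zeroʳ (suc (suc k)) ⟩
  0                               ≡⟨ cong (1 *_) (k>n⇒nCk≡0 {0} {suc k} (s≤s z≤n)) ⟨
  1 * (0 C suc k)                 ∎
suc-*-C-suc (suc n) zero    = trans (+-identityʳ _) (trans (nC1≡n (suc (suc n))) (sym (*-identityʳ (suc (suc n)))))
suc-*-C-suc (suc n) (suc k) = begin
  suc (suc k) * (suc (suc n) C suc (suc k)) ≡⟨ cong (suc (suc k) *_) (nCk+nC[k+1]≡[n+1]C[k+1] (suc n) (suc k)) ⟨
  suc (suc k) * (a + b)                     ≡⟨ absorb-rearrange k a b ⟩
  a + suc k * a + suc (suc k) * b           ≡⟨ cong₂ (λ x y → a + x + y) (suc-*-C-suc n k) (suc-*-C-suc n (suc k)) ⟩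
  a + suc n * (n C k) + suc n * (n C suc k) ≡⟨ +-assoc a _ _ ⟩
  a + (suc n * (n C k) + suc n * (n C suc k)) ≡⟨ cong (a +_) (*-distribˡ-+ (suc n) (n C k) (n C suc k)) ⟨
  a + suc n * (n C k + n C suc k)           ≡⟨ cong (λ x → a + suc n * x) (nCk+nC[k+1]≡[n+1]C[k+1] n k) ⟩
  a + suc n * a                             ∎
  where
  a = suc n C suc k
  b = suc n C suc (suc k)

ballot-step : ∀ h k → ballot (suc h) (suc k) ≡ ballot (suc (suc h)) (suc k) + ballot h k
ballot-step h k = begin
  ballot (h + 0) k + ∑[ i < k ] ballot (h + suc i) k
    ≡⟨ cong₂ _+_ (cong (λ z → ballot z k) (+-identityʳ h)) (∑<-cong k (λ i _ → cong (λ z → ballot z k) (+-suc h i))) ⟩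
  ballot h k + ∑[ i < k ] ballot (suc h + i) k
    ≡⟨ +-comm (ballot h k) _ ⟩
  ∑[ i < k ] ballot (suc h + i) k + ballot h k
    ≡⟨ cong (_+ ballot h k) (∑<-vanishing-tail k (suc k) (λ i → ballot (suc h + i) k) (n≤1+n k)
         (λ i k≤i _ → ballot-vanish k (s≤s (≤-trans k≤i (m≤n+m i h))))) ⟨
  ∑[ i < suc k ] ballot (suc h + i) k + ballot h k ∎

ballot-diagonal : ∀ k → ballot k k ≡ 1
ballot-diagonal zero    = refl
ballot-diagonal (suc k) = cong₂ _+_
  (trans (cong (λ z → ballot z k) (+-identityʳ k)) (ballot-diagonal k))
  (∑<-zero k (λ i _ → ballot-vanish k (subst (k <_) (sym (+-suc k i)) (s≤s (m≤m+n k i)))))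

-- ballot h k = C(2k ∸ h, k) ∸ C(2k ∸ h, 1 + k), stated without subtraction.
BallotBinomial : ℕ → ℕ → Set
BallotBinomial h k = ballot h k + (2 * k ∸ h) C suc k ≡ (2 * k ∸ h) C k

ballot-binomial-diagonal : ∀ k → BallotBinomial k k
ballot-binomial-diagonal k = begin
  ballot k k + (2 * k ∸ k) C suc k ≡⟨ cong₂ _+_ (ballot-diagonal k) (cong (_C suc k) 2k∸k≡k) ⟩
  1 + k C suc k                    ≡⟨ cong (1 +_) (k>n⇒nCk≡0 (n<1+n k)) ⟩
  1                                ≡⟨ nCn≡1 k ⟨
  k C k                            ≡⟨ cong (_C k) 2k∸k≡k ⟨
  (2 * k ∸ k) C k                  ∎
  where
  2k∸k≡k : 2 * k ∸ k ≡ k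
  2k∸k≡k = trans (cong (_∸ k) (2*k≡k+k k)) (m+n∸m≡n k k)

ballot-binomial-zero : ∀ k → BallotBinomial 1 (suc k) → BallotBinomial 0 (suc k)
ballot-binomial-zero k hyp = begin
  ballot 1 K + (2 * K) C suc K        ≡⟨ cong (λ n → ballot 1 K + n C suc K) (2*suc k) ⟩
  ballot 1 K + suc n C suc K          ≡⟨ cong (ballot 1 K +_) (nCk+nC[k+1]≡[n+1]C[k+1] n K) ⟨
  ballot 1 K + (n C K + n C suc K)    ≡⟨ pascal-rearrange (ballot 1 K) (n C K) (n C suc K) ⟩
  ballot 1 K + n C suc K + n C K      ≡⟨ cong (_+ n C K) (subst (λ m → ballot 1 K + m C suc K ≡ m C K) (cong (_∸ 1) (2*suc k)) hyp) ⟩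
  n C K + n C K                       ≡⟨ cong (_+ n C K) (middle-binomial-symmetric k) ⟨
  n C k + n C K                       ≡⟨ nCk+nC[k+1]≡[n+1]C[k+1] n k ⟩
  suc n C K                           ≡⟨ cong (_C K) (2*suc k) ⟨
  (2 * K) C K                         ∎
  where
  K = suc k
  n = suc (2 * k)

ballot-binomial-step : ∀ k h → h ≤ 2 * k →
  BallotBinomial (suc (suc h)) (suc k) → BallotBinomial h k → BallotBinomial (suc h) (suc k)
ballot-binomial-step k h h≤2k hypᵃ hypᵇ = begin
  ballot (suc h) K + (2 * K ∸ suc h) C suc K ≡⟨ cong₂ _+_ (ballot-step h k) (cong (_C suc K) 2K∸[1+h]≡1+n) ⟩
  x + y + suc n C suc K                      ≡⟨ cong (x + y +_) (nCk+nC[k+1]≡[n+1]C[k+1] n K) ⟨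
  x + y + (n C K + n C suc K)                ≡⟨ exchange x y (n C K) (n C suc K) ⟩
  (x + n C suc K) + (y + n C K)              ≡⟨ cong₂ _+_ (subst (λ m → x + m C suc K ≡ m C K) 2K∸[2+h]≡n hypᵃ) hypᵇ ⟩
  n C K + n C k                              ≡⟨ +-comm (n C K) (n C k) ⟩
  n C k + n C K                              ≡⟨ nCk+nC[k+1]≡[n+1]C[k+1] n k ⟩
  suc n C K                                  ≡⟨ cong (_C K) 2K∸[1+h]≡1+n ⟨
  (2 * K ∸ suc h) C K                        ∎
  where
  K = suc k
  n = 2 * k ∸ h
  x = ballot (suc (suc h)) K
  y = ballot h k
  2K∸[2+h]≡n : 2 * K ∸ suc (suc h) ≡ n
  2K∸[2+h]≡n = cong (_∸ suc (suc h)) (2*suc k)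
  2K∸[1+h]≡1+n : 2 * K ∸ suc h ≡ suc n
  2K∸[1+h]≡1+n = trans (cong (_∸ suc h) (2*suc k)) (+-∸-assoc 1 h≤2k)

-- Induction on k, and for fixed k downwards on h (d = k ∸ h).
ballot-binomial : ∀ {h k} → h ≤ k → BallotBinomial h k
ballot-binomial {h} h≤k = go _ _ h (m+[n∸m]≡n h≤k)
  where
  go : ∀ k d h → h + d ≡ k → BallotBinomial h k
  go k       zero    h       h+0≡k = subst (BallotBinomial h) (trans (sym (+-identityʳ h)) h+0≡k) (ballot-binomial-diagonal h)
  go zero    (suc d) h       h+d≡0 = contradiction (trans (sym (+-suc h d)) h+d≡0) λ ()
  go (suc k) (suc d) zero    d≡k   = ballot-binomial-zero k (go (suc k) d 1 d≡k)
  go (suc k) (suc d) (suc h) h+d≡k = ballot-binomial-step k h h≤2k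
    (go (suc k) d (suc (suc h)) (trans (sym (+-suc (suc h) d)) h+d≡k))
    (go k (k ∸ h) h (m+[n∸m]≡n (<⇒≤ h<k)))
    where
    h<k : h < k
    h<k = subst (h <_) (suc-injective h+d≡k) (m<m+n h (s≤s z≤n))
    h≤2k : h ≤ 2 * k
    h≤2k = ≤-trans (<⇒≤ h<k) (m≤m+n k (k + 0))

suc-*-middle-C-suc : ∀ l → suc l * ((2 * l) C suc l) ≡ l * ((2 * l) C l)
suc-*-middle-C-suc zero    = refl
suc-*-middle-C-suc (suc l) = begin
  suc (suc l) * ((2 * suc l) C suc (suc l)) ≡⟨ cong (λ m → suc (suc l) * (m C suc (suc l))) (2*suc l) ⟩
  suc (suc l) * (suc n C suc (suc l))       ≡⟨ suc-*-C-suc n (suc l) ⟩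
  suc n * (n C suc l)                       ≡⟨ cong (suc n *_) (middle-binomial-symmetric l) ⟨
  suc n * (n C l)                           ≡⟨ suc-*-C-suc n l ⟨
  suc l * (suc n C suc l)                   ≡⟨ cong (λ m → suc l * (m C suc l)) (2*suc l) ⟨
  suc l * ((2 * suc l) C suc l)             ∎
  where
  n = suc (2 * l)

catalan-binomial : ∀ l → suc l * catalan l ≡ (2 * l) C l
catalan-binomial l = +-cancelʳ-≡ (l * c) (suc l * catalan l) c (begin
  suc l * catalan l + l * c           ≡⟨ cong (suc l * catalan l +_) (suc-*-middle-C-suc l) ⟨
  suc l * catalan l + suc l * d       ≡⟨ *-distribˡ-+ (suc l) (catalan l) d ⟨
  suc l * (catalan l + d)             ≡⟨ cong (suc l *_) (ballot-binomial {k = l} z≤n) ⟩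
  suc l * c                           ∎)
  where
  c = (2 * l) C l
  d = (2 * l) C suc l

-- Sums of Catalan products over compositions with bounded prefix sums

-- catalanSum h ps M = ∑ ballot h ℓ₀ · catalan ℓ₁ ⋯ catalan ℓ_k over (ℓ₀, …, ℓ_k) ∈ ℕ^(k+1)
-- with ℓ₀ + ⋯ + ℓ_k = M and ℓ₀ + ⋯ + ℓ_j ≥ ps j for all j < k.
catalanSum : ∀ {k} → ℕ → Vector ℕ k → ℕ → ℕ
catalanSum {zero}  h ps M = ballot h M
catalanSum {suc k} h ps M =
  ∑[ x < suc M ] when (head ps ≤ᵇ x) (ballot h x * catalanSum 0 (Vector.map (_∸ x) (tail ps)) (M ∸ x))

catalanSum-cong : ∀ {k} h {ps qs : Vector ℕ k} M → (∀ i → ps i ≡ qs i) → catalanSum h ps M ≡ catalanSum h qs M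
catalanSum-cong {zero}  h M eq = refl
catalanSum-cong {suc k} h M eq = ∑<-cong (suc M) (λ x _ →
  cong₂ (λ q c → when (q ≤ᵇ x) (ballot h x * c)) (eq Fin.zero) (catalanSum-cong 0 (M ∸ x) (cong (_∸ x) ∘ eq ∘ Fin.suc)))

private
  suc≤ᵇsuc : ∀ p x → (suc p ≤ᵇ suc x) ≡ (p ≤ᵇ x)
  suc≤ᵇsuc zero    x = refl
  suc≤ᵇsuc (suc p) x = refl

  ≤ᵇ-+ : ∀ q x z → (q ≤ᵇ x + z) ≡ (q ∸ x ≤ᵇ z)
  ≤ᵇ-+ q       zero    z = refl
  ≤ᵇ-+ zero    (suc x) z = refl
  ≤ᵇ-+ (suc q) (suc x) z = trans (suc≤ᵇsuc q (x + z)) (≤ᵇ-+ q x z)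

ballot-shift-sum : ∀ h y A → suc y ≤ A → ∑[ i < A ] ballot (h + i) y ≡ ∑[ x < suc y ] ballot h x * catalan (y ∸ x)
ballot-shift-sum h y A y<A = begin
  ∑[ i < A ] ballot (h + i) y
    ≡⟨ ∑<-vanishing-tail (suc y) A (λ i → ballot (h + i) y) y<A (λ i y<i _ → ballot-vanish y (≤-trans y<i (m≤n+m i h))) ⟩
  ∑[ i < suc y ] ballot (h + i) y
    ≡⟨ ∑<-cong (suc y) (λ i _ → cong (λ z → ballot (z + i) y) (+-identityʳ h)) ⟨
  ballot (suc (h + 0)) (suc y)
    ≡⟨ ballot-convolution y h 0 ⟨
  ∑[ x < suc y ] ballot h x * catalan (y ∸ x) ∎

catalanSum-pred-shift : ∀ {k} h (ps : Vector ℕ (suc k)) p M A → head ps ≡ suc p → suc M ≤ A →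
  ∑[ i < A ] catalanSum (pred h + i) (Vector.map (_∸ 1) ps) M ≡ catalanSum h ps (suc M)
catalanSum-pred-shift h ps p M A head≡1+p M<A = begin
  ∑[ i < A ] ∑[ x < suc M ] when (c x) (ballot (pred h + i) x * R x)
    ≡⟨ ∑<-comm A (suc M) (λ i x → when (c x) (ballot (pred h + i) x * R x)) ⟩
  ∑[ x < suc M ] ∑[ i < A ] when (c x) (ballot (pred h + i) x * R x)
    ≡⟨ ∑<-cong (suc M) (λ x x≤M → first-step x (s≤s⁻¹ x≤M)) ⟩
  ∑[ x < suc M ] when (head ps ≤ᵇ suc x) (ballot h (suc x) * catalanSum 0 (Vector.map (_∸ suc x) (tail ps)) (M ∸ x))
    ≡⟨ cong (_+ ∑[ x < suc M ] when (head ps ≤ᵇ suc x) (ballot h (suc x) * catalanSum 0 (Vector.map (_∸ suc x) (tail ps)) (M ∸ x)))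
            (cong (λ q → when (q ≤ᵇ 0) (ballot h 0 * catalanSum 0 (Vector.map (_∸ 0) (tail ps)) (suc M))) head≡1+p) ⟨
  catalanSum h ps (suc M) ∎
  where
  c : ℕ → Bool
  c x = head ps ∸ 1 ≤ᵇ x
  R : ℕ → ℕ
  R x = catalanSum 0 (Vector.map (_∸ x) (tail (Vector.map (_∸ 1) ps))) (M ∸ x)
  first-step : ∀ x → x ≤ M → ∑[ i < A ] when (c x) (ballot (pred h + i) x * R x)
             ≡ when (head ps ≤ᵇ suc x) (ballot h (suc x) * catalanSum 0 (Vector.map (_∸ suc x) (tail ps)) (M ∸ x))
  first-step x x≤M = begin
    ∑[ i < A ] when (c x) (ballot (pred h + i) x * R x)   ≡⟨ when-∑< (c x) A (λ i → ballot (pred h + i) x * R x) ⟨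
    when (c x) (∑[ i < A ] ballot (pred h + i) x * R x)   ≡⟨ cong (when (c x)) (*-distribʳ-∑< A (R x) (λ i → ballot (pred h + i) x)) ⟨
    when (c x) ((∑[ i < A ] ballot (pred h + i) x) * R x) ≡⟨ cong (λ b → when (c x) (b * R x)) (ballot-suc h x A (≤-trans (s≤s x≤M) M<A)) ⟩
    when (c x) (ballot h (suc x) * R x)
      ≡⟨ cong₂ (λ b r → when b (ballot h (suc x) * r))
           (trans (cong (λ q → q ∸ 1 ≤ᵇ x) head≡1+p) (sym (trans (cong (_≤ᵇ suc x) head≡1+p) (suc≤ᵇsuc p x))))
           (catalanSum-cong 0 (M ∸ x) (λ j → ∸-+-assoc (ps (Fin.suc j)) 1 x)) ⟩
    when (head ps ≤ᵇ suc x) (ballot h (suc x) * catalanSum 0 (Vector.map (_∸ suc x) (tail ps)) (M ∸ x)) ∎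

-- Summing over the starting heights h + i splits off a new first part, via ballot-shift-sum.
catalanSum-shift : ∀ {k} h (ps : Vector ℕ k) M A → suc M ≤ A →
  ∑[ i < A ] catalanSum (h + i) ps M ≡ catalanSum h (0 Vector.∷ ps) M
catalanSum-shift {zero}  h ps M A M<A = ballot-shift-sum h M A M<A
catalanSum-shift {suc k} h ps M A M<A = begin
  ∑[ i < A ] ∑[ y < suc M ] when (q ≤ᵇ y) (ballot (h + i) y * R y)
    ≡⟨ ∑<-comm A (suc M) (λ i y → when (q ≤ᵇ y) (ballot (h + i) y * R y)) ⟩
  ∑[ y < suc M ] ∑[ i < A ] when (q ≤ᵇ y) (ballot (h + i) y * R y)
    ≡⟨ ∑<-cong (suc M) (λ y y≤M → split-first-part y (s≤s⁻¹ y≤M)) ⟩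
  ∑[ y < suc M ] ∑[ x < suc y ] F x y
    ≡⟨ ∑<-triangle M F ⟩
  ∑[ x < suc M ] ∑[ z < suc (M ∸ x) ] F x (x + z)
    ≡⟨ ∑<-cong (suc M) (λ x _ → trans (∑<-cong (suc (M ∸ x)) (λ z _ → regroup x z))
         (sym (*-distribˡ-∑< (suc (M ∸ x)) (ballot h x) (λ z → when (q ∸ x ≤ᵇ z) (catalan z * R′ x z))))) ⟩
  ∑[ x < suc M ] ballot h x * catalanSum 0 (Vector.map (_∸ x) ps) (M ∸ x) ∎
  where
  q = head ps
  R : ℕ → ℕ
  R y = catalanSum 0 (Vector.map (_∸ y) (tail ps)) (M ∸ y)
  R′ : ℕ → ℕ → ℕ
  R′ x z = catalanSum 0 (Vector.map (_∸ z) (Vector.map (_∸ x) (tail ps))) (M ∸ x ∸ z)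
  F : ℕ → ℕ → ℕ
  F x y = when (q ≤ᵇ y) (ballot h x * catalan (y ∸ x) * R y)
  split-first-part : ∀ y → y ≤ M → ∑[ i < A ] when (q ≤ᵇ y) (ballot (h + i) y * R y) ≡ ∑[ x < suc y ] F x y
  split-first-part y y≤M = begin
    ∑[ i < A ] when (q ≤ᵇ y) (ballot (h + i) y * R y)     ≡⟨ when-∑< (q ≤ᵇ y) A (λ i → ballot (h + i) y * R y) ⟨
    when (q ≤ᵇ y) (∑[ i < A ] ballot (h + i) y * R y)     ≡⟨ cong (when (q ≤ᵇ y)) (*-distribʳ-∑< A (R y) (λ i → ballot (h + i) y)) ⟨
    when (q ≤ᵇ y) ((∑[ i < A ] ballot (h + i) y) * R y)
      ≡⟨ cong (λ s → when (q ≤ᵇ y) (s * R y)) (ballot-shift-sum h y A (≤-trans (s≤s y≤M) M<A)) ⟩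
    when (q ≤ᵇ y) ((∑[ x < suc y ] ballot h x * catalan (y ∸ x)) * R y)
      ≡⟨ cong (when (q ≤ᵇ y)) (*-distribʳ-∑< (suc y) (R y) (λ x → ballot h x * catalan (y ∸ x))) ⟩
    when (q ≤ᵇ y) (∑[ x < suc y ] ballot h x * catalan (y ∸ x) * R y)
      ≡⟨ when-∑< (q ≤ᵇ y) (suc y) (λ x → ballot h x * catalan (y ∸ x) * R y) ⟩
    ∑[ x < suc y ] F x y ∎
  regroup : ∀ x z → F x (x + z) ≡ ballot h x * when (q ∸ x ≤ᵇ z) (catalan z * R′ x z)
  regroup x z = begin
    when (q ≤ᵇ x + z) (ballot h x * catalan (x + z ∸ x) * R (x + z))
      ≡⟨ cong₂ (λ b c → when b (ballot h x * catalan c * R (x + z))) (≤ᵇ-+ q x z) (m+n∸m≡n x z) ⟩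
    when (q ∸ x ≤ᵇ z) (ballot h x * catalan z * R (x + z))
      ≡⟨ cong (λ r → when (q ∸ x ≤ᵇ z) (ballot h x * catalan z * r))
           (trans (catalanSum-cong 0 (M ∸ (x + z)) (λ j → sym (∸-+-assoc (ps (Fin.suc j)) x z)))
                  (cong (catalanSum 0 (Vector.map (_∸ z) (Vector.map (_∸ x) (tail ps)))) (sym (∸-+-assoc M x z)))) ⟩
    when (q ∸ x ≤ᵇ z) (ballot h x * catalan z * R′ x z)
      ≡⟨ cong (when (q ∸ x ≤ᵇ z)) (*-assoc (ballot h x) (catalan z) (R′ x z)) ⟩
    when (q ∸ x ≤ᵇ z) (ballot h x * (catalan z * R′ x z))
      ≡⟨ when-*ˡ (q ∸ x ≤ᵇ z) (ballot h x) (catalan z * R′ x z) ⟩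
    ballot h x * when (q ∸ x ≤ᵇ z) (catalan z * R′ x z) ∎

-- Paths with prescribed down-steps

lower : Bool → ℕ → ℕ
lower true  h = pred h
lower false h = h

-- paths bs h counts the sequences h = s₀, s₁, …, s_(length bs) = 0 of naturals with
-- s_(j+1) ≥ s_j ∸ 1 if the j-th bit is true and s_(j+1) ≥ s_j if it is false.
paths : List Bool → ℕ → ℕ
paths []       h = ballot h 0
paths (b ∷ bs) h = ∑[ i < suc (length bs) ] paths bs (lower b h + i)

trues : List Bool → ℕ
trues []           = 0
trues (true ∷ bs)  = suc (trues bs)
trues (false ∷ bs) = trues bs

trues≤length : ∀ bs → trues bs ≤ length bs
trues≤length []           = z≤n
trues≤length (true ∷ bs)  = s≤s (trues≤length bs)
trues≤length (false ∷ bs) = m≤n⇒m≤1+n (trues≤length bs)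

paths-vanish : ∀ bs {h} → trues bs < h → paths bs h ≡ 0
paths-vanish []           {suc h} _         = refl
paths-vanish (true ∷ bs)  {suc h} (s≤s b<h) = ∑<-zero (suc (length bs)) (λ i _ → paths-vanish bs (≤-trans b<h (m≤m+n h i)))
paths-vanish (false ∷ bs) {h}     b<h       = ∑<-zero (suc (length bs)) (λ i _ → paths-vanish bs (≤-trans b<h (m≤m+n h i)))

interval : ℕ → ℕ → List ℕ
interval a zero    = []
interval a (suc L) = a ∷ interval (suc a) L

length-map-interval : ∀ {A : Set} (f : ℕ → A) a L → length (map f (interval a L)) ≡ L
length-map-interval f a zero    = refl
length-map-interval f a (suc L) = cong suc (length-map-interval f (suc a) L)

map-cong-interval : ∀ {A : Set} {f g : ℕ → A} a L → (∀ v → a ≤ v → f v ≡ g v) → map f (interval a L) ≡ map g (interval a L)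
map-cong-interval a zero    eq = refl
map-cong-interval a (suc L) eq = cong₂ _∷_ (eq a ≤-refl) (map-cong-interval (suc a) L (λ v a<v → eq v (<⇒≤ a<v)))

notIn : ∀ {m} → Vec ℕ m → ℕ → Bool
notIn t v = not (does (v ∈? toList t))

notIn-head : ∀ {m} v (t : Vec ℕ m) → notIn (v ∷ t) v ≡ false
notIn-head v t = cong not (dec-true (v ∈? toList (v ∷ t)) (here refl))

data IncreasingIn : ℕ → ℕ → ∀ {m} → Vec ℕ m → Set where
  []  : ∀ {a b} → a ≤ b → IncreasingIn a b []
  _∷_ : ∀ {a b x m} {t : Vec ℕ m} → a ≤ x → IncreasingIn (suc x) b t → IncreasingIn a b (x ∷ t)

IncreasingIn-weaken : ∀ {a a′ b m} {t : Vec ℕ m} → a ≤ a′ → IncreasingIn a′ b t → IncreasingIn a b t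
IncreasingIn-weaken a≤a′ ([] a′≤b)   = [] (≤-trans a≤a′ a′≤b)
IncreasingIn-weaken a≤a′ (a′≤x ∷ inc) = ≤-trans a≤a′ a′≤x ∷ inc

length+lower≤upper : ∀ {a b m} {t : Vec ℕ m} → IncreasingIn a b t → m + a ≤ b
length+lower≤upper ([] a≤b) = a≤b
length+lower≤upper {a} {b} {suc m} {x ∷ _} (a≤x ∷ inc) =
  ≤-trans (s≤s (+-monoʳ-≤ m a≤x)) (subst (_≤ b) (+-suc m x) (length+lower≤upper inc))

notIn-below : ∀ {b m} v {t : Vec ℕ m} → IncreasingIn (suc v) b t → notIn t v ≡ true
notIn-below v inc = cong not (dec-false (v ∈? _) (∉ inc))
  where
  ∉ : ∀ {b m} {t : Vec ℕ m} → IncreasingIn (suc v) b t → ¬ (v ∈ toList t)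
  ∉ (v<x ∷ _)   (here refl) = <-irrefl refl v<x
  ∉ (v<x ∷ inc) (there v∈t) = ∉ (IncreasingIn-weaken (m≤n⇒m≤1+n v<x) inc) v∈t

notIn-above-head : ∀ {m} x (t : Vec ℕ m) {v} → x < v → notIn (x ∷ t) v ≡ notIn t v
notIn-above-head x t {v} x<v with v ≡ᵇ x in v≡ᵇx
... | true  = contradiction (≡ᵇ⇒≡ v x (subst T (sym v≡ᵇx) _)) (≢-sym (<⇒≢ x<v))
... | false = refl

length≤interval : ∀ {v₀ L b m} {t : Vec ℕ m} → v₀ + L ≡ b → IncreasingIn v₀ b t → m ≤ L
length≤interval {v₀} {L} {b} {m} refl inc = +-cancelʳ-≤ v₀ m L (subst (m + v₀ ≤_) (+-comm v₀ L) (length+lower≤upper inc))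

-- thresholds t v₀ i = t_i − v₀ − i counts the values in [v₀, t_i) that do not occur in t.
thresholds : ∀ {m} → Vec ℕ m → ℕ → Vector ℕ m
thresholds t v₀ i = lookup t i ∸ (v₀ + toℕ i)

paths-interval-suc : ∀ {m} (t : Vec ℕ m) v₀ L h {b} → notIn t v₀ ≡ b →
  paths (map (notIn t) (interval v₀ (suc L))) h ≡ ∑[ i < suc L ] paths (map (notIn t) (interval (suc v₀) L)) (lower b h + i)
paths-interval-suc t v₀ L h refl =
  cong (λ n → ∑[ i < suc n ] paths (map (notIn t) (interval (suc v₀) L)) (lower (notIn t v₀) h + i))
       (length-map-interval (notIn t) (suc v₀) L)

private
  n∸m≡suc[n∸suc[m]] : ∀ {m L} → suc m ≤ L → L ∸ m ≡ suc (L ∸ suc m)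
  n∸m≡suc[n∸suc[m]] {m} {suc L} (s≤s m≤L) = +-∸-assoc 1 m≤L

  thresholds-head : ∀ {m} v₀ (t : Vec ℕ m) i → (0 Vector.∷ thresholds t (suc v₀)) i ≡ thresholds (v₀ ∷ t) v₀ i
  thresholds-head v₀ t Fin.zero    = sym (trans (cong (v₀ ∸_) (+-identityʳ v₀)) (n∸n≡0 v₀))
  thresholds-head v₀ t (Fin.suc i) = cong (lookup t i ∸_) (sym (+-suc v₀ (toℕ i)))

  thresholds-suc : ∀ {m} v₀ (t : Vec ℕ m) i → thresholds t (suc v₀) i ≡ Vector.map (_∸ 1) (thresholds t v₀) i
  thresholds-suc v₀ t i = trans (cong (lookup t i ∸_) (+-comm 1 (v₀ + toℕ i))) (sym (∸-+-assoc (lookup t i) (v₀ + toℕ i) 1))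

paths-catalanSum : ∀ L v₀ {b m} (t : Vec ℕ m) h → v₀ + L ≡ b → IncreasingIn v₀ b t →
  paths (map (notIn t) (interval v₀ L)) h ≡ catalanSum h (thresholds t v₀) (L ∸ m)
paths-catalanSum zero    v₀ []      h _ _ = refl
paths-catalanSum zero    v₀ (x ∷ t) h v₀+0≡b inc with () ← length≤interval v₀+0≡b inc
paths-catalanSum (suc L) v₀ []      h v₀+L≡b _ = begin
  paths (map (notIn []) (interval v₀ (suc L))) h                ≡⟨ paths-interval-suc [] v₀ L h refl ⟩
  ∑[ i < suc L ] paths (map (notIn []) (interval (suc v₀) L)) (pred h + i)
    ≡⟨ ∑<-cong (suc L) (λ i _ → paths-catalanSum L (suc v₀) [] (pred h + i) v₀+1+L≡b
         ([] (m+n≤o⇒m≤o (suc v₀) (≤-reflexive v₀+1+L≡b)))) ⟩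
  ∑[ i < suc L ] ballot (pred h + i) L                          ≡⟨ ballot-suc h L (suc L) ≤-refl ⟩
  ballot h (suc L)                                              ∎
  where
  v₀+1+L≡b : suc v₀ + L ≡ _
  v₀+1+L≡b = trans (sym (+-suc v₀ L)) v₀+L≡b
paths-catalanSum (suc L) v₀ {b} {suc m} (x ∷ t) h v₀+L≡b (v₀≤x ∷ inc) with m≤n⇒m<n∨m≡n v₀≤x
... | inj₂ refl = begin
  paths (map (notIn (v₀ ∷ t)) (interval v₀ (suc L))) h           ≡⟨ paths-interval-suc (v₀ ∷ t) v₀ L h (notIn-head v₀ t) ⟩
  ∑[ i < suc L ] paths (map (notIn (v₀ ∷ t)) (interval (suc v₀) L)) (h + i)
    ≡⟨ ∑<-cong (suc L) (λ i _ → cong (λ bs → paths bs (h + i)) (map-cong-interval (suc v₀) L (λ v → notIn-above-head v₀ t))) ⟩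
  ∑[ i < suc L ] paths (map (notIn t) (interval (suc v₀) L)) (h + i)
    ≡⟨ ∑<-cong (suc L) (λ i _ → paths-catalanSum L (suc v₀) t (h + i) (trans (sym (+-suc v₀ L)) v₀+L≡b) inc) ⟩
  ∑[ i < suc L ] catalanSum (h + i) (thresholds t (suc v₀)) (L ∸ m)
    ≡⟨ catalanSum-shift h (thresholds t (suc v₀)) (L ∸ m) (suc L) (s≤s (m∸n≤m L m)) ⟩
  catalanSum h (0 Vector.∷ thresholds t (suc v₀)) (L ∸ m)         ≡⟨ catalanSum-cong h (L ∸ m) (thresholds-head v₀ t) ⟩
  catalanSum h (thresholds (v₀ ∷ t) v₀) (L ∸ m)                    ∎
... | inj₁ v₀<x = begin
  paths (map (notIn (x ∷ t)) (interval v₀ (suc L))) h             ≡⟨ paths-interval-suc (x ∷ t) v₀ L h (notIn-below v₀ inc′) ⟩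
  ∑[ i < suc L ] paths (map (notIn (x ∷ t)) (interval (suc v₀) L)) (pred h + i)
    ≡⟨ ∑<-cong (suc L) (λ i _ → paths-catalanSum L (suc v₀) (x ∷ t) (pred h + i) v₀+1+L≡b inc′) ⟩
  ∑[ i < suc L ] catalanSum (pred h + i) (thresholds (x ∷ t) (suc v₀)) (L ∸ suc m)
    ≡⟨ ∑<-cong (suc L) (λ i _ → catalanSum-cong (pred h + i) (L ∸ suc m) (thresholds-suc v₀ (x ∷ t))) ⟩
  ∑[ i < suc L ] catalanSum (pred h + i) (Vector.map (_∸ 1) (thresholds (x ∷ t) v₀)) (L ∸ suc m)
    ≡⟨ catalanSum-pred-shift h (thresholds (x ∷ t) v₀) (x ∸ suc v₀) (L ∸ suc m) (suc L)
         (trans (cong (x ∸_) (+-identityʳ v₀)) (n∸m≡suc[n∸suc[m]] v₀<x)) (s≤s (m∸n≤m L (suc m))) ⟩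
  catalanSum h (thresholds (x ∷ t) v₀) (suc (L ∸ suc m))          ≡⟨ cong (catalanSum h (thresholds (x ∷ t) v₀)) (n∸m≡suc[n∸suc[m]] 1+m≤L) ⟨
  catalanSum h (thresholds (x ∷ t) v₀) (L ∸ m)                    ∎
  where
  inc′ : IncreasingIn (suc v₀) b (x ∷ t)
  inc′ = v₀<x ∷ inc
  v₀+1+L≡b : suc v₀ + L ≡ b
  v₀+1+L≡b = trans (sym (+-suc v₀ L)) v₀+L≡b
  1+m≤L : suc m ≤ L
  1+m≤L = length≤interval v₀+1+L≡b inc′

trues-notIn : ∀ L v₀ {b m} (t : Vec ℕ m) → v₀ + L ≡ b → IncreasingIn v₀ b t →
  trues (map (notIn t) (interval v₀ L)) ≡ L ∸ m
trues-notIn zero    v₀ []      _ _ = refl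
trues-notIn zero    v₀ (x ∷ t) v₀+0≡b inc with () ← length≤interval v₀+0≡b inc
trues-notIn (suc L) v₀ []      v₀+L≡b _ = cong suc (trues-notIn L (suc v₀) [] v₀+1+L≡b ([] (m+n≤o⇒m≤o (suc v₀) (≤-reflexive v₀+1+L≡b))))
  where
  v₀+1+L≡b : suc v₀ + L ≡ _
  v₀+1+L≡b = trans (sym (+-suc v₀ L)) v₀+L≡b
trues-notIn (suc L) v₀ {b} {suc m} (x ∷ t) v₀+L≡b (v₀≤x ∷ inc) with m≤n⇒m<n∨m≡n v₀≤x
... | inj₂ refl = begin
  trues (notIn (v₀ ∷ t) v₀ ∷ map (notIn (v₀ ∷ t)) (interval (suc v₀) L))
    ≡⟨ cong (λ c → trues (c ∷ map (notIn (v₀ ∷ t)) (interval (suc v₀) L))) (notIn-head v₀ t) ⟩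
  trues (map (notIn (v₀ ∷ t)) (interval (suc v₀) L))
    ≡⟨ cong trues (map-cong-interval (suc v₀) L (λ v → notIn-above-head v₀ t)) ⟩
  trues (map (notIn t) (interval (suc v₀) L))
    ≡⟨ trues-notIn L (suc v₀) t (trans (sym (+-suc v₀ L)) v₀+L≡b) inc ⟩
  L ∸ m ∎
... | inj₁ v₀<x = begin
  trues (notIn (x ∷ t) v₀ ∷ map (notIn (x ∷ t)) (interval (suc v₀) L))
    ≡⟨ cong (λ c → trues (c ∷ map (notIn (x ∷ t)) (interval (suc v₀) L))) (notIn-below v₀ inc′) ⟩
  suc (trues (map (notIn (x ∷ t)) (interval (suc v₀) L)))
    ≡⟨ cong suc (trues-notIn L (suc v₀) (x ∷ t) v₀+1+L≡b inc′) ⟩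
  suc (L ∸ suc m)
    ≡⟨ n∸m≡suc[n∸suc[m]] (length≤interval v₀+1+L≡b inc′) ⟨
  L ∸ m ∎
  where
  inc′ : IncreasingIn (suc v₀) b (x ∷ t)
  inc′ = v₀<x ∷ inc
  v₀+1+L≡b : suc v₀ + L ≡ b
  v₀+1+L≡b = trans (sym (+-suc v₀ L)) v₀+L≡b

sumWhere : {A : Set} → (A → Bool) → (A → ℕ) → List A → ℕ
sumWhere p g []       = 0
sumWhere p g (x ∷ xs) = when (p x) (g x) + sumWhere p g xs

sumWhere-cong : ∀ {A : Set} {p q : A → Bool} g (xs : List A) → (∀ x → p x ≡ q x) → sumWhere p g xs ≡ sumWhere q g xs
sumWhere-cong g []       eq = refl
sumWhere-cong g (x ∷ xs) eq = cong₂ (λ b s → when b (g x) + s) (eq x) (sumWhere-cong g xs eq)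

sumWhere-++ : ∀ {A : Set} p g (xs ys : List A) → sumWhere p g (xs ++ ys) ≡ sumWhere p g xs + sumWhere p g ys
sumWhere-++ p g []       ys = refl
sumWhere-++ p g (x ∷ xs) ys = trans (cong (when (p x) (g x) +_) (sumWhere-++ p g xs ys)) (sym (+-assoc (when (p x) (g x)) _ _))

sumWhere-∧ˡ : ∀ {A : Set} b p g (xs : List A) → sumWhere (λ x → b ∧ p x) g xs ≡ when b (sumWhere p g xs)
sumWhere-∧ˡ true  p g xs       = refl
sumWhere-∧ˡ false p g []       = refl
sumWhere-∧ˡ false p g (x ∷ xs) = sumWhere-∧ˡ false p g xs

sumWhere-*ˡ : ∀ {A : Set} p c g (xs : List A) → sumWhere p (λ x → c * g x) xs ≡ c * sumWhere p g xs
sumWhere-*ˡ p c g []       = sym (*-zeroʳ c)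
sumWhere-*ˡ p c g (x ∷ xs) = begin
  when (p x) (c * g x) + sumWhere p (λ y → c * g y) xs ≡⟨ cong₂ _+_ (when-*ˡ (p x) c (g x)) (sumWhere-*ˡ p c g xs) ⟩
  c * when (p x) (g x) + c * sumWhere p g xs           ≡⟨ *-distribˡ-+ c (when (p x) (g x)) _ ⟨
  c * sumWhere p g (x ∷ xs)                            ∎

sumWhere-map : ∀ {A B : Set} p g (f : A → B) xs → sumWhere p g (map f xs) ≡ sumWhere (p ∘ f) (g ∘ f) xs
sumWhere-map p g f []       = refl
sumWhere-map p g f (x ∷ xs) = cong (when (p (f x)) (g (f x)) +_) (sumWhere-map p g f xs)

sumWhere-concatMap : ∀ {A B : Set} p g (f : A → List B) xs → sumWhere p g (concatMap f xs) ≡ sum (map (sumWhere p g ∘ f) xs)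
sumWhere-concatMap p g f []       = refl
sumWhere-concatMap p g f (x ∷ xs) = trans (sumWhere-++ p g (f x) (concatMap f xs)) (cong (sumWhere p g (f x) +_) (sumWhere-concatMap p g f xs))

sumWhere-listsOf-suc : ∀ p g k xs →
  sumWhere p g (listsOf (suc k) xs) ≡ sum (map (λ x → sumWhere (p ∘ (x ∷_)) (g ∘ (x ∷_)) (listsOf k xs)) xs)
sumWhere-listsOf-suc p g k xs = trans (sumWhere-concatMap p g (λ x → map (x ∷_) (listsOf k xs)) xs)
  (cong sum (map-cong (λ x → sumWhere-map p g (x ∷_) (listsOf k xs)) xs))

does-≡ : ∀ {P : Set} (P? : Dec P) {b : Bool} → (T b → P) → (P → T b) → does P? ≡ b
does-≡ P? sound complete = det (proof P?) (fromEquivalence sound complete)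

length-filter≡sumWhere : ∀ {A : Set} {ℓ} {P : Pred A ℓ} (P? : Decidable P) xs → length (filter P? xs) ≡ sumWhere (does ∘ P?) (λ _ → 1) xs
length-filter≡sumWhere P? []       = refl
length-filter≡sumWhere P? (x ∷ xs) with does (P? x)
... | true  = cong suc (length-filter≡sumWhere P? xs)
... | false = length-filter≡sumWhere P? xs

sum-map-applyUpTo : ∀ h (f : ℕ → ℕ) n → sum (map h (applyUpTo f n)) ≡ ∑[ i < n ] h (f i)
sum-map-applyUpTo h f zero    = refl
sum-map-applyUpTo h f (suc n) = cong (h (f 0) +_) (sum-map-applyUpTo h (f ∘ suc) n)

sum-map-range1 : ∀ h n → sum (map h (range1 n)) ≡ ∑[ i < n ] h (suc i)
sum-map-range1 h n = trans (cong sum (sym (map-∘ (upTo n)))) (sum-map-applyUpTo (h ∘ suc) (λ i → i) n)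

-- Counting increasing parking completions

≤ᵇ-gap : ∀ v x → ((suc v ≤ᵇ x) ∧ (x ≤ᵇ v)) ≡ false
≤ᵇ-gap v x with x ≤? v
... | yes x≤v = cong (_∧ (x ≤ᵇ v)) (≤ᵇ-false (s≤s x≤v))
... | no  x≰v = trans (cong ((suc v ≤ᵇ x) ∧_) (dec-false (x ≤? v) x≰v)) (∧-zeroʳ (suc v ≤ᵇ x))

chainᵇ : ℕ → List ℕ → List ℕ → Bool
chainᵇ lo []      []       = true
chainᵇ lo (x ∷ c) (w ∷ vs) = ((lo ≤ᵇ x) ∧ (x ≤ᵇ w)) ∧ chainᵇ x c vs
chainᵇ lo []      (_ ∷ _)  = false
chainᵇ lo (_ ∷ _) []       = false

chainᵇ-sound : ∀ lo c vs → T (chainᵇ lo c vs) → Linked _≤_ (lo ∷ c) × Pointwise _≤_ c vs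
chainᵇ-sound lo []      []       _  = [-] , []
chainᵇ-sound lo (x ∷ c) (w ∷ vs) ok with Equivalence.to T-∧ ok
... | first , ok′ with Equivalence.to T-∧ first | chainᵇ-sound x c vs ok′
...   | lo≤x , x≤w | linked , pointwise = (≤ᵇ⇒≤ lo x lo≤x ∷ linked) , (≤ᵇ⇒≤ x w x≤w ∷ pointwise)

chainᵇ-complete : ∀ lo c vs → Linked _≤_ (lo ∷ c) → Pointwise _≤_ c vs → T (chainᵇ lo c vs)
chainᵇ-complete lo []      []       _                  _                     = _
chainᵇ-complete lo (x ∷ c) (w ∷ vs) (lo≤x ∷ linked) (x≤w ∷ pointwise) =
  Equivalence.from T-∧ (Equivalence.from T-∧ (≤⇒≤ᵇ lo≤x , ≤⇒≤ᵇ x≤w) , chainᵇ-complete x c vs linked pointwise)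

interval-within : ∀ a L {lo hi} → lo ≤ a → a + L ≤ hi → All (λ w → lo ≤ w × w < hi) (interval a L)
interval-within a zero    lo≤a a+0≤hi = []
interval-within a (suc L) {lo} {hi} lo≤a a+L≤hi =
  (lo≤a , ≤-trans (s≤s (m≤m+n a L)) a+1+L≤hi) ∷ interval-within (suc a) L (m≤n⇒m≤1+n lo≤a) a+1+L≤hi
  where
  a+1+L≤hi : suc a + L ≤ hi
  a+1+L≤hi = subst (_≤ hi) (+-suc a L) a+L≤hi

length-filter≡trues : ∀ {ℓ} {P : Pred ℕ ℓ} (P? : Decidable P) xs → length (filter P? xs) ≡ trues (map (does ∘ P?) xs)
length-filter≡trues P? []       = refl
length-filter≡trues P? (x ∷ xs) with does (P? x)
... | true  = cong suc (length-filter≡trues P? xs)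
... | false = length-filter≡trues P? xs

module _ (n : ℕ) where

  completions : ℕ → List ℕ → ℕ
  completions lo vs = sumWhere (λ c → chainᵇ lo c vs) (λ _ → 1) (listsOf (length vs) (range1 n))

  completions-∷ : ∀ lo w vs → completions lo (w ∷ vs) ≡ ∑[ i < n ] when ((lo ≤ᵇ suc i) ∧ (suc i ≤ᵇ w)) (completions (suc i) vs)
  completions-∷ lo w vs = begin
    completions lo (w ∷ vs)
      ≡⟨ sumWhere-listsOf-suc (λ c → chainᵇ lo c (w ∷ vs)) (λ _ → 1) (length vs) (range1 n) ⟩
    sum (map (λ x → sumWhere (λ c → ((lo ≤ᵇ x) ∧ (x ≤ᵇ w)) ∧ chainᵇ x c vs) (λ _ → 1) (listsOf (length vs) (range1 n))) (range1 n))
      ≡⟨ cong sum (map-cong (λ x → sumWhere-∧ˡ ((lo ≤ᵇ x) ∧ (x ≤ᵇ w)) (λ c → chainᵇ x c vs) (λ _ → 1)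
                                               (listsOf (length vs) (range1 n))) (range1 n)) ⟩
    sum (map (λ x → when ((lo ≤ᵇ x) ∧ (x ≤ᵇ w)) (completions x vs)) (range1 n))
      ≡⟨ sum-map-range1 (λ x → when ((lo ≤ᵇ x) ∧ (x ≤ᵇ w)) (completions x vs)) n ⟩
    ∑[ i < n ] when ((lo ≤ᵇ suc i) ∧ (suc i ≤ᵇ w)) (completions (suc i) vs) ∎

  -- Either c₁ = lo, or c₁ > lo.
  completions-split : ∀ lo w vs → 1 ≤ lo → lo ≤ w → w < suc n →
    completions lo (w ∷ vs) ≡ completions lo vs + completions (suc lo) (w ∷ vs)
  completions-split (suc lo) w vs _ lo<w w<1+n = begin
    completions (suc lo) (w ∷ vs)          ≡⟨ completions-∷ (suc lo) w vs ⟩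
    ∑[ i < n ] when ((suc lo ≤ᵇ suc i) ∧ (suc i ≤ᵇ w)) (completions (suc i) vs)
      ≡⟨ ∑<-isolate n lo (≤-trans lo<w (s≤s⁻¹ w<1+n)) differ
           (cong (λ b → when (b ∧ (suc lo ≤ᵇ w)) (completions (suc lo) vs)) (≤ᵇ-false {suc (suc lo)} {suc lo} ≤-refl)) ⟩
    when ((suc lo ≤ᵇ suc lo) ∧ (suc lo ≤ᵇ w)) (completions (suc lo) vs)
      + ∑[ i < n ] when ((suc (suc lo) ≤ᵇ suc i) ∧ (suc i ≤ᵇ w)) (completions (suc i) vs)
      ≡⟨ cong₂ _+_ (cong₂ (λ a b → when (a ∧ b) (completions (suc lo) vs)) (≤ᵇ-true {suc lo} ≤-refl) (≤ᵇ-true lo<w))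
                   (sym (completions-∷ (suc (suc lo)) w vs)) ⟩
    completions (suc lo) vs + completions (suc (suc lo)) (w ∷ vs) ∎
    where
    same-test : ∀ {a b i} → a ≡ b → when (a ∧ (suc i ≤ᵇ w)) (completions (suc i) vs) ≡ when (b ∧ (suc i ≤ᵇ w)) (completions (suc i) vs)
    same-test {i = i} a≡b = cong (λ a → when (a ∧ (suc i ≤ᵇ w)) (completions (suc i) vs)) a≡b
    differ : ∀ i → i ≢ lo → when ((suc lo ≤ᵇ suc i) ∧ (suc i ≤ᵇ w)) (completions (suc i) vs)
                          ≡ when ((suc (suc lo) ≤ᵇ suc i) ∧ (suc i ≤ᵇ w)) (completions (suc i) vs)
    differ i i≢lo with <-cmp i lo
    ... | tri< i<lo _ _ = same-test (trans (≤ᵇ-false (s≤s i<lo)) (sym (≤ᵇ-false (s≤s (m≤n⇒m≤1+n i<lo)))))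
    ... | tri≈ _ i≡lo _ = contradiction i≡lo i≢lo
    ... | tri> _ _ lo<i = same-test (trans (≤ᵇ-true (s≤s (<⇒≤ lo<i))) (sym (≤ᵇ-true (s≤s lo<i))))

  completions-above-head : ∀ v vs → completions (suc v) (v ∷ vs) ≡ 0
  completions-above-head v vs = trans (completions-∷ (suc v) v vs)
    (∑<-zero n (λ i _ → cong (λ b → when b (completions (suc i) vs)) (≤ᵇ-gap v (suc i))))

  -- Split by the number a of entries equal to lo.
  completions-by-count : ∀ lo ws → 1 ≤ lo → All (λ w → lo < w × w < suc n) ws →
    completions lo ws ≡ ∑[ a < suc (length ws) ] completions (suc lo) (drop a ws)
  completions-by-count lo []       _    _ = refl
  completions-by-count lo (w ∷ ws) 1≤lo ((lo<w , w<1+n) ∷ ws-within) = begin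
    completions lo (w ∷ ws)
      ≡⟨ completions-split lo w ws 1≤lo (<⇒≤ lo<w) w<1+n ⟩
    completions lo ws + completions (suc lo) (w ∷ ws)
      ≡⟨ cong (_+ completions (suc lo) (w ∷ ws)) (completions-by-count lo ws 1≤lo ws-within) ⟩
    ∑[ a < suc (length ws) ] completions (suc lo) (drop a ws) + completions (suc lo) (w ∷ ws)
      ≡⟨ +-comm _ (completions (suc lo) (w ∷ ws)) ⟩
    completions (suc lo) (w ∷ ws) + ∑[ a < suc (length ws) ] completions (suc lo) (drop a ws) ∎

  completions-from-0 : ∀ vs → completions 0 vs ≡ completions 1 vs
  completions-from-0 []       = refl
  completions-from-0 (w ∷ vs) = trans (completions-∷ 0 w vs) (sym (completions-∷ 1 w vs))

  -- Dropping the first h admissible values of [v₀, v₀ + L) corresponds to starting the path at height h.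
  completions-paths : ∀ {ℓ} {P : Pred ℕ ℓ} (P? : Decidable P) L v₀ h → 1 ≤ v₀ → v₀ + L ≤ suc n →
    h ≤ trues (map (does ∘ P?) (interval v₀ L)) →
    completions v₀ (drop h (filter P? (interval v₀ L))) ≡ paths (map (does ∘ P?) (interval v₀ L)) h

  completions-paths-above : ∀ {ℓ} {P : Pred ℕ ℓ} (P? : Decidable P) L v₀ h → 1 ≤ v₀ → v₀ + suc L ≤ suc n →
    h ≤ trues (map (does ∘ P?) (interval (suc v₀) L)) →
    completions v₀ (drop h (filter P? (interval (suc v₀) L)))
      ≡ ∑[ i < suc (length (map (does ∘ P?) (interval (suc v₀) L))) ] paths (map (does ∘ P?) (interval (suc v₀) L)) (h + i)

  completions-paths P? zero    v₀ zero 1≤v₀ _ _ = refl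
  completions-paths P? (suc L) v₀ h    1≤v₀ v₀+L≤1+n h≤trues with does (P? v₀) | h
  ... | false | g      = completions-paths-above P? L v₀ g 1≤v₀ v₀+L≤1+n h≤trues
  ... | true  | suc h′ = completions-paths-above P? L v₀ h′ 1≤v₀ v₀+L≤1+n (s≤s⁻¹ h≤trues)
  ... | true  | zero   = begin
    completions v₀ (v₀ ∷ us)
      ≡⟨ completions-split v₀ v₀ us 1≤v₀ ≤-refl (<-≤-trans (m<m+n v₀ (s≤s z≤n)) v₀+L≤1+n) ⟩
    completions v₀ us + completions (suc v₀) (v₀ ∷ us) ≡⟨ cong (completions v₀ us +_) (completions-above-head v₀ us) ⟩
    completions v₀ us + 0                             ≡⟨ +-identityʳ _ ⟩
    completions v₀ us                                 ≡⟨ completions-paths-above P? L v₀ 0 1≤v₀ v₀+L≤1+n z≤n ⟩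
    ∑[ i < suc (length bits) ] paths bits i           ∎
    where
    us = filter P? (interval (suc v₀) L)
    bits = map (does ∘ P?) (interval (suc v₀) L)

  completions-paths-above P? L v₀ h 1≤v₀ v₀+L≤1+n h≤trues = begin
    completions v₀ (drop h us)
      ≡⟨ completions-by-count v₀ (drop h us) 1≤v₀ (drop⁺ h (filter⁺ P? (interval-within (suc v₀) L ≤-refl v₀+1+L≤1+n))) ⟩
    ∑[ a < suc (length (drop h us)) ] completions (suc v₀) (drop a (drop h us))
      ≡⟨ cong (λ k → ∑[ a < suc k ] completions (suc v₀) (drop a (drop h us)))
              (trans (length-drop h us) (cong (_∸ h) (length-filter≡trues P? (interval (suc v₀) L)))) ⟩
    ∑[ a < suc (trues bits ∸ h) ] completions (suc v₀) (drop a (drop h us))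
      ≡⟨ ∑<-cong (suc (trues bits ∸ h)) (λ a a≤ → trans (cong (completions (suc v₀)) (drop-drop h a us))
           (completions-paths P? L (suc v₀) (h + a) (s≤s z≤n) v₀+1+L≤1+n
             (subst (h + a ≤_) (m+[n∸m]≡n h≤trues) (+-monoʳ-≤ h (s≤s⁻¹ a≤))))) ⟩
    ∑[ a < suc (trues bits ∸ h) ] paths bits (h + a)
      ≡⟨ ∑<-vanishing-tail (suc (trues bits ∸ h)) (suc (length bits)) (λ a → paths bits (h + a))
           (s≤s (≤-trans (m∸n≤m (trues bits) h) (trues≤length bits)))
           (λ a trues∸h<a _ → paths-vanish bits (subst (_< h + a) (m+[n∸m]≡n h≤trues) (+-monoʳ-< h trues∸h<a))) ⟨
    ∑[ a < suc (length bits) ] paths bits (h + a) ∎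
    where
    us = filter P? (interval (suc v₀) L)
    bits = map (does ∘ P?) (interval (suc v₀) L)
    v₀+1+L≤1+n : suc v₀ + L ≤ suc n
    v₀+1+L≤1+n = subst (_≤ suc n) (+-suc v₀ L) v₀+L≤1+n

-- The sum over L_n(t)

boundedᵇ : ∀ {k} → Vector ℕ k → ℕ → List ℕ → Bool
boundedᵇ {zero}  ps M ℓ       = sum ℓ ≡ᵇ M
boundedᵇ {suc k} ps M []      = (head ps ≤ᵇ 0) ∧ boundedᵇ (tail ps) M []
boundedᵇ {suc k} ps M (x ∷ ℓ) = ((head ps ≤ᵇ x) ∧ (x ≤ᵇ M)) ∧ boundedᵇ (Vector.map (_∸ x) (tail ps)) (M ∸ x) ℓ

PrefixBounded : ∀ {k} → Vector ℕ k → ℕ → List ℕ → Set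
PrefixBounded ps M ℓ = (∀ i → ps i ≤ sum (take (suc (toℕ i)) ℓ)) × sum ℓ ≡ M

boundedᵇ-sound : ∀ {k} (ps : Vector ℕ k) M ℓ → T (boundedᵇ ps M ℓ) → PrefixBounded ps M ℓ
boundedᵇ-sound {zero}  ps M ℓ       ok = (λ ()) , ≡ᵇ⇒≡ (sum ℓ) M ok
boundedᵇ-sound {suc k} ps M []      ok with Equivalence.to T-∧ ok
... | ps₀≤0 , ok′ with boundedᵇ-sound (tail ps) M [] ok′
...   | bounded , sum≡M = bound , sum≡M
  where
  bound : ∀ i → ps i ≤ 0
  bound Fin.zero    = ≤ᵇ⇒≤ (head ps) 0 ps₀≤0
  bound (Fin.suc i) = bounded i
boundedᵇ-sound {suc k} ps M (x ∷ ℓ) ok with Equivalence.to T-∧ ok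
... | first , ok′ with Equivalence.to T-∧ first | boundedᵇ-sound (Vector.map (_∸ x) (tail ps)) (M ∸ x) ℓ ok′
...   | ps₀≤x , x≤M | bounded , sum≡M∸x = bound , trans (cong (x +_) sum≡M∸x) (m+[n∸m]≡n (≤ᵇ⇒≤ x M x≤M))
  where
  bound : ∀ i → ps i ≤ sum (take (suc (toℕ i)) (x ∷ ℓ))
  bound Fin.zero    = ≤-trans (≤ᵇ⇒≤ (head ps) x ps₀≤x) (≤-reflexive (sym (+-identityʳ x)))
  bound (Fin.suc i) = ≤-trans (m≤n+m∸n (ps (Fin.suc i)) x) (+-monoʳ-≤ x (bounded i))

boundedᵇ-complete : ∀ {k} (ps : Vector ℕ k) M ℓ → PrefixBounded ps M ℓ → T (boundedᵇ ps M ℓ)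
boundedᵇ-complete {zero}  ps M ℓ       (_ , sum≡M) = ≡⇒≡ᵇ (sum ℓ) M sum≡M
boundedᵇ-complete {suc k} ps M []      (bounded , sum≡M) =
  Equivalence.from T-∧ (≤⇒≤ᵇ (bounded Fin.zero) , boundedᵇ-complete (tail ps) M [] ((bounded ∘ Fin.suc) , sum≡M))
boundedᵇ-complete {suc k} ps M (x ∷ ℓ) (bounded , sum≡M) =
  Equivalence.from T-∧ (Equivalence.from T-∧ (≤⇒≤ᵇ (≤-trans (bounded Fin.zero) (≤-reflexive (+-identityʳ x))) , ≤⇒≤ᵇ x≤M) ,
    boundedᵇ-complete (Vector.map (_∸ x) (tail ps)) (M ∸ x) ℓ (bounded′ , trans (sym (m+n∸m≡n x (sum ℓ))) (cong (_∸ x) sum≡M)))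
  where
  x≤M : x ≤ M
  x≤M = subst (x ≤_) sum≡M (m≤m+n x (sum ℓ))
  bounded′ : ∀ i → ps (Fin.suc i) ∸ x ≤ sum (take (suc (toℕ i)) ℓ)
  bounded′ i = subst (ps (Fin.suc i) ∸ x ≤_) (m+n∸m≡n x _) (∸-monoˡ-≤ x (bounded (Fin.suc i)))

sumWhere-boundedᵇ : ∀ {k} N (ps : Vector ℕ k) M → M ≤ N →
  sumWhere (boundedᵇ ps M) (product ∘ map catalan) (listsOf (suc k) (upTo (suc N))) ≡ catalanSum 0 ps M
sumWhere-boundedᵇ {zero}  N ps M M≤N = begin
  sumWhere (λ ℓ → sum ℓ ≡ᵇ M) (product ∘ map catalan) (listsOf 1 (upTo (suc N)))
    ≡⟨ sumWhere-listsOf-suc (λ ℓ → sum ℓ ≡ᵇ M) (product ∘ map catalan) 0 (upTo (suc N)) ⟩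
  sum (map (λ x → when (x + 0 ≡ᵇ M) (catalan x * 1) + 0) (upTo (suc N)))
    ≡⟨ cong sum (map-cong (λ x → trans (+-identityʳ _) (cong₂ (λ y z → when (y ≡ᵇ M) z) (+-identityʳ x) (*-identityʳ (catalan x))))
                          (upTo (suc N))) ⟩
  sum (map (λ x → when (x ≡ᵇ M) (catalan x)) (upTo (suc N)))
    ≡⟨ sum-map-applyUpTo (λ x → when (x ≡ᵇ M) (catalan x)) (λ i → i) (suc N) ⟩
  ∑[ x < suc N ] when (x ≡ᵇ M) (catalan x)
    ≡⟨ ∑<-delta (suc N) M catalan (s≤s M≤N) ⟩
  catalan M ∎
sumWhere-boundedᵇ {suc k} N ps M M≤N = begin
  sumWhere (boundedᵇ ps M) (product ∘ map catalan) (listsOf (suc (suc k)) (upTo (suc N)))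
    ≡⟨ sumWhere-listsOf-suc (boundedᵇ ps M) (product ∘ map catalan) (suc k) (upTo (suc N)) ⟩
  sum (map (λ x → sumWhere (λ ℓ → first x ∧ boundedᵇ (rest x) (M ∸ x) ℓ) (λ ℓ → catalan x * product (map catalan ℓ))
                           (listsOf (suc k) (upTo (suc N)))) (upTo (suc N)))
    ≡⟨ cong sum (map-cong first-part (upTo (suc N))) ⟩
  sum (map (λ x → when (first x) (catalan x * catalanSum 0 (rest x) (M ∸ x))) (upTo (suc N)))
    ≡⟨ sum-map-applyUpTo (λ x → when (first x) (catalan x * catalanSum 0 (rest x) (M ∸ x))) (λ i → i) (suc N) ⟩
  ∑[ x < suc N ] when ((head ps ≤ᵇ x) ∧ (x ≤ᵇ M)) (catalan x * catalanSum 0 (rest x) (M ∸ x))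
    ≡⟨ ∑<-restrict N M (head ps ≤ᵇ_) (λ x → catalan x * catalanSum 0 (rest x) (M ∸ x)) M≤N ⟩
  catalanSum 0 ps M ∎
  where
  first : ℕ → Bool
  first x = (head ps ≤ᵇ x) ∧ (x ≤ᵇ M)
  rest : ℕ → Vector ℕ k
  rest x = Vector.map (_∸ x) (tail ps)
  first-part : ∀ x → sumWhere (λ ℓ → first x ∧ boundedᵇ (rest x) (M ∸ x) ℓ) (λ ℓ → catalan x * product (map catalan ℓ))
                               (listsOf (suc k) (upTo (suc N)))
                   ≡ when (first x) (catalan x * catalanSum 0 (rest x) (M ∸ x))
  first-part x = begin
    sumWhere (λ ℓ → first x ∧ boundedᵇ (rest x) (M ∸ x) ℓ) (λ ℓ → catalan x * product (map catalan ℓ)) L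
      ≡⟨ sumWhere-∧ˡ (first x) (boundedᵇ (rest x) (M ∸ x)) (λ ℓ → catalan x * product (map catalan ℓ)) L ⟩
    when (first x) (sumWhere (boundedᵇ (rest x) (M ∸ x)) (λ ℓ → catalan x * product (map catalan ℓ)) L)
      ≡⟨ cong (when (first x)) (sumWhere-*ˡ (boundedᵇ (rest x) (M ∸ x)) (catalan x) (product ∘ map catalan) L) ⟩
    when (first x) (catalan x * sumWhere (boundedᵇ (rest x) (M ∸ x)) (product ∘ map catalan) L)
      ≡⟨ cong (λ s → when (first x) (catalan x * s)) (sumWhere-boundedᵇ N (rest x) (M ∸ x) (≤-trans (m∸n≤m M x) M≤N)) ⟩
    when (first x) (catalan x * catalanSum 0 (rest x) (M ∸ x)) ∎
    where
    L = listsOf (suc k) (upTo (suc N))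

private
  ℕtoℚᵘ : ℕ → ℚᵘ
  ℕtoℚᵘ a = mkℚᵘ (ℤ.+ a) 0

  toℚᵘ-ℕtoℚ : ∀ a → toℚᵘ (ℕtoℚ a) ℚᵘ.≃ ℕtoℚᵘ a
  toℚᵘ-ℕtoℚ a = toℚᵘ-fromℚᵘ (ℕtoℚᵘ a)

ℕtoℚ-+ : ∀ a b → ℕtoℚ (a + b) ≡ ℕtoℚ a ℚ.+ ℕtoℚ b
ℕtoℚ-+ a b = toℚᵘ-injective (≃.begin
  toℚᵘ (ℕtoℚ (a + b))                ≃.≈⟨ toℚᵘ-ℕtoℚ (a + b) ⟩
  ℕtoℚᵘ (a + b)
    ≃.≈⟨ *≡* (cong (ℤ._* ℤ.+ 1) (trans (ℤ.pos-+ a b) (sym (cong₂ ℤ._+_ (ℤ.*-identityʳ (ℤ.+ a)) (ℤ.*-identityʳ (ℤ.+ b)))))) ⟩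
  ℕtoℚᵘ a ℚᵘ.+ ℕtoℚᵘ b                 ≃.≈⟨ ℚᵘ.+-cong (toℚᵘ-ℕtoℚ a) (toℚᵘ-ℕtoℚ b) ⟨
  toℚᵘ (ℕtoℚ a) ℚᵘ.+ toℚᵘ (ℕtoℚ b)     ≃.≈⟨ toℚᵘ-homo-+ (ℕtoℚ a) (ℕtoℚ b) ⟨
  toℚᵘ (ℕtoℚ a ℚ.+ ℕtoℚ b)             ≃.∎)

ℕtoℚ-* : ∀ a b → ℕtoℚ (a * b) ≡ ℕtoℚ a ℚ.* ℕtoℚ b
ℕtoℚ-* a b = toℚᵘ-injective (≃.begin
  toℚᵘ (ℕtoℚ (a * b))                ≃.≈⟨ toℚᵘ-ℕtoℚ (a * b) ⟩
  ℕtoℚᵘ (a * b)                      ≃.≈⟨ *≡* (cong (ℤ._* ℤ.+ 1) (ℤ.pos-* a b)) ⟩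
  ℕtoℚᵘ a ℚᵘ.* ℕtoℚᵘ b                 ≃.≈⟨ ℚᵘ.*-cong (toℚᵘ-ℕtoℚ a) (toℚᵘ-ℕtoℚ b) ⟨
  toℚᵘ (ℕtoℚ a) ℚᵘ.* toℚᵘ (ℕtoℚ b)     ≃.≈⟨ toℚᵘ-homo-* (ℕtoℚ a) (ℕtoℚ b) ⟨
  toℚᵘ (ℕtoℚ a ℚ.* ℕtoℚ b)             ≃.∎)

catQ≡catalan : ∀ l → catQ l ≡ ℕtoℚ (catalan l)
catQ≡catalan l = toℚᵘ-injective (≃.begin
  toℚᵘ (catQ l)                        ≃.≈⟨ toℚᵘ-homo-* (ℤ.+ 1 / suc l) (ℕtoℚ c) ⟩
  toℚᵘ (ℤ.+ 1 / suc l) ℚᵘ.* toℚᵘ (ℕtoℚ c) ≃.≈⟨ ℚᵘ.*-cong (toℚᵘ-fromℚᵘ (mkℚᵘ (ℤ.+ 1) l)) (toℚᵘ-ℕtoℚ c) ⟩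
  mkℚᵘ (ℤ.+ 1) l ℚᵘ.* ℕtoℚᵘ c            ≃.≈⟨ *≡* cross-multiplied ⟩
  ℕtoℚᵘ (catalan l)                    ≃.≈⟨ toℚᵘ-ℕtoℚ (catalan l) ⟨
  toℚᵘ (ℕtoℚ (catalan l))              ≃.∎)
  where
  c = (2 * l) C l
  [1+l]catalan≡catalan[1+l] : suc l * catalan l ≡ catalan l * (suc l * 1)
  [1+l]catalan≡catalan[1+l] = trans (*-comm (suc l) (catalan l)) (cong (catalan l *_) (sym (*-identityʳ (suc l))))
  cross-multiplied : (ℤ.+ 1 ℤ.* ℤ.+ c) ℤ.* ℤ.+ 1 ≡ ℤ.+ catalan l ℤ.* ℤ.+ (suc l * 1)
  cross-multiplied = trans (ℤ.*-identityʳ (ℤ.+ 1 ℤ.* ℤ.+ c)) (trans (ℤ.*-identityˡ (ℤ.+ c))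
    (trans (cong ℤ.+_ (trans (sym (catalan-binomial l)) [1+l]catalan≡catalan[1+l])) (ℤ.pos-* (catalan l) (suc l * 1))))

sumQ-map-filter : ∀ {A : Set} {ℓ} {P : Pred A ℓ} (P? : Decidable P) (g : A → ℕ) xs →
  sumQ (map (ℕtoℚ ∘ g) (filter P? xs)) ≡ ℕtoℚ (sumWhere (does ∘ P?) g xs)
sumQ-map-filter P? g []       = refl
sumQ-map-filter P? g (x ∷ xs) with does (P? x)
... | true  = trans (cong (ℕtoℚ (g x) ℚ.+_) (sumQ-map-filter P? g xs)) (sym (ℕtoℚ-+ (g x) _))
... | false = sumQ-map-filter P? g xs

prodQ-map-catQ : ∀ ℓ → prodQ (map catQ ℓ) ≡ ℕtoℚ (product (map catalan ℓ))
prodQ-map-catQ []      = refl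
prodQ-map-catQ (x ∷ ℓ) = trans (cong₂ ℚ._*_ (catQ≡catalan x) (prodQ-map-catQ ℓ)) (sym (ℕtoℚ-* (catalan x) _))

0∷-linked : ∀ {c} → Linked _≤_ c → Linked _≤_ (0 ∷ c)
0∷-linked []        = [-]
0∷-linked [-]       = z≤n ∷ [-]
0∷-linked (x≤y ∷ l) = z≤n ∷ (x≤y ∷ l)

does-isIPC? : ∀ n {m} (t : Vec ℕ m) c → does (isIPC? n t c) ≡ chainᵇ 0 c (compl n t)
does-isIPC? n t c = does-≡ (isIPC? n t c)
  (λ ok → let linked , pointwise = chainᵇ-sound 0 c (compl n t) ok in Linked.tail linked , pointwise)
  (λ (linked , pointwise) → chainᵇ-complete 0 c (compl n t) (0∷-linked linked) pointwise)

does-isL? : ∀ n {m} (t : Vec ℕ m) ℓ → does (isL? n t ℓ) ≡ boundedᵇ (thresholds t 1) (n ∸ m) ℓ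
does-isL? n {m} t ℓ = does-≡ (isL? n t ℓ) (boundedᵇ-sound (thresholds t 1) (n ∸ m) ℓ) (boundedᵇ-complete (thresholds t 1) (n ∸ m) ℓ)

increasingIn-lookup : ∀ {a b m} (t : Vec ℕ m) → a ≤ b → (∀ i → a ≤ lookup t i × lookup t i < b) →
  (∀ i j → toℕ i < toℕ j → lookup t i < lookup t j) → IncreasingIn a b t
increasingIn-lookup []      a≤b _      _          = [] a≤b
increasingIn-lookup (x ∷ t) a≤b bounds increasing =
  proj₁ (bounds Fin.zero) ∷ increasingIn-lookup t (proj₂ (bounds Fin.zero))
    (λ j → increasing Fin.zero (Fin.suc j) (s≤s z≤n) , proj₂ (bounds (Fin.suc j)))
    (λ i j i<j → increasing (Fin.suc i) (Fin.suc j) (s≤s i<j))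

applyUpTo≡interval : ∀ (f : ℕ → ℕ) a n → (∀ i → f i ≡ a + i) → applyUpTo f n ≡ interval a n
applyUpTo≡interval f a zero    _  = refl
applyUpTo≡interval f a (suc n) eq =
  cong₂ _∷_ (trans (eq 0) (+-identityʳ a)) (applyUpTo≡interval (f ∘ suc) (suc a) n (λ i → trans (eq (suc i)) (+-suc a i)))

range1≡interval : ∀ n → range1 n ≡ interval 1 n
range1≡interval n = trans (map-applyUpTo (λ i → i) suc n) (applyUpTo≡interval suc 1 n (λ _ → refl))

length-IPC : ∀ n {m} (t : Vec ℕ m) → IncreasingIn 1 (suc n) t →
  length (IPC n t) ≡ catalanSum 0 (thresholds t 1) (n ∸ m)
length-IPC n {m} t inc = begin
  length (IPC n t)
    ≡⟨ length-filter≡sumWhere (isIPC? n t) (listsOf (n ∸ m) (range1 n)) ⟩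
  sumWhere (does ∘ isIPC? n t) (λ _ → 1) (listsOf (n ∸ m) (range1 n))
    ≡⟨ sumWhere-cong (λ _ → 1) (listsOf (n ∸ m) (range1 n)) (does-isIPC? n t) ⟩
  sumWhere (λ c → chainᵇ 0 c (compl n t)) (λ _ → 1) (listsOf (n ∸ m) (range1 n))
    ≡⟨ cong (λ k → sumWhere (λ c → chainᵇ 0 c (compl n t)) (λ _ → 1) (listsOf k (range1 n))) length-compl ⟨
  completions n 0 (compl n t)                        ≡⟨ completions-from-0 n (compl n t) ⟩
  completions n 1 (compl n t)                        ≡⟨ cong (completions n 1) compl≡ ⟩
  completions n 1 (filter P? (interval 1 n))         ≡⟨ completions-paths n P? n 1 0 ≤-refl ≤-refl z≤n ⟩
  paths (map (notIn t) (interval 1 n)) 0             ≡⟨ paths-catalanSum n 1 t 0 refl inc ⟩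
  catalanSum 0 (thresholds t 1) (n ∸ m)              ∎
  where
  P? = λ k → ¬? (k ∈? toList t)
  compl≡ : compl n t ≡ filter P? (interval 1 n)
  compl≡ = cong (filter P?) (range1≡interval n)
  length-compl : length (compl n t) ≡ n ∸ m
  length-compl = trans (cong length compl≡) (trans (length-filter≡trues P? (interval 1 n)) (trues-notIn n 1 t refl inc))

sumWhere-Lset : ∀ n {m} (t : Vec ℕ m) →
  sumWhere (does ∘ isL? n t) (product ∘ map catalan) (listsOf (suc m) (upTo (suc (n ∸ m)))) ≡ catalanSum 0 (thresholds t 1) (n ∸ m)
sumWhere-Lset n {m} t = trans (sumWhere-cong (product ∘ map catalan) (listsOf (suc m) (upTo (suc (n ∸ m)))) (does-isL? n t))
  (sumWhere-boundedᵇ (n ∸ m) (thresholds t 1) (n ∸ m) ≤-refl)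

theorem1p3 : (n m : ℕ) → 1 ≤ n → (t : Vec ℕ m) → StrictlyIncreasingIn n t →
    ℕtoℚ (length (IPC n t)) ≡ sumQ (map (λ ℓ → prodQ (map catQ ℓ)) (Lset n t))
theorem1p3 n m _ t (bounds , increasing) = begin
  ℕtoℚ (length (IPC n t))                                   ≡⟨ cong ℕtoℚ (length-IPC n t inc) ⟩
  ℕtoℚ (catalanSum 0 (thresholds t 1) (n ∸ m))              ≡⟨ cong ℕtoℚ (sumWhere-Lset n t) ⟨
  ℕtoℚ (sumWhere (does ∘ isL? n t) (product ∘ map catalan) (listsOf (suc m) (upTo (suc (n ∸ m)))))
    ≡⟨ sumQ-map-filter (isL? n t) (product ∘ map catalan) (listsOf (suc m) (upTo (suc (n ∸ m)))) ⟨
  sumQ (map (ℕtoℚ ∘ product ∘ map catalan) (Lset n t))      ≡⟨ cong sumQ (map-cong (sym ∘ prodQ-map-catQ) (Lset n t)) ⟩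
  sumQ (map (λ ℓ → prodQ (map catQ ℓ)) (Lset n t))          ∎
  where
  inc : IncreasingIn 1 (suc n) t
  inc = increasingIn-lookup t (s≤s z≤n) (λ i → proj₁ (bounds i) , s≤s (proj₂ (bounds i))) increasing
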